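{- For a graph $G$, let $\widetilde G$ be the graph obtained by adding, for each vertex $v$ of $G$, a new vertex $v'$ adjacent only to $v$. Let $C_n$ be the cycle on $n\ge3$ vertices and $P_n$ the path on $n$ vertices. Then $\lim_{n\to\infty}\mathcal{I}(\widetilde{C_n})=\lim_{n\to\infty}\mathcal{I}(\widetilde{P_n})$.
   Context: For a finite simple graph $G$: a matching is a set of pairwise vertex-disjoint edges; it is maximal if not contained in a larger matching. $\nu(G)$ is the maximum matching size, $\mathcal{T}_0(G)$ the number of maximal matchings, $\mathcal{T}_1(G)$ the sum of the sizes of all maximal matchings, and $\mathcal{I}(G)=\frac{\mathcal{T}_1(G)}{\nu(G)\mathcal{T}_0(G)}$ (equal to $1$ by convention if $\nu(G)=0$). -}

module Defs where

open import Data.Bool using (Bool; true; false; _∧_; _∨_; not; if_then_else_)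
open import Data.Nat as ℕ using (ℕ; zero; suc; _⊔_; _≤_)
open import Data.Fin using (Fin; zero; suc; fromℕ; _↑ˡ_; _↑ʳ_; _≟_)
open import Data.List using (List; []; _∷_; map; _++_; length; filter; foldr; tabulate)
open import Data.Bool.ListAction using (all; any)
open import Data.Nat.ListAction using (sum)
open import Data.Product using (_×_; _,_; ∃; Σ)
open import Relation.Nullary.Decidable using (⌊_⌋)
open import Data.Integer using (+_)
open import Data.Rational using (ℚ; _/_; 1ℚ; 0ℚ; _-_; ∣_∣; _<_)

-- A finite simple graph on vertex set Fin n, given by its list of edges
-- (each edge a pair of distinct vertices; each edge listed once).
record Graph : Set where
  constructor mkGraph
  field
    size  : ℕ
    edges : List (Fin size × Fin size)
open Graph public

Edge : ℕ → Set
Edge n = Fin n × Fin n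

_=ᵥ_ : ∀ {n} → Fin n → Fin n → Bool
u =ᵥ v = ⌊ u ≟ v ⌋

meets : ∀ {n} → Edge n → Edge n → Bool
meets (a , b) (c , d) = (a =ᵥ c) ∨ (a =ᵥ d) ∨ (b =ᵥ c) ∨ (b =ᵥ d)

sublists : ∀ {A : Set} → List A → List (List A)
sublists [] = [] ∷ []
sublists (x ∷ xs) = let r = sublists xs in map (x ∷_) r ++ r

isMatching : ∀ {n} → List (Edge n) → Bool
isMatching [] = true
isMatching (e ∷ es) = all (λ f → not (meets e f)) es ∧ isMatching es

addable : ∀ {n} → List (Edge n) → Edge n → Bool
addable M e = all (λ f → not (meets e f)) M

-- a matching M ⊆ E(G) is maximal iff no edge of G can be added to it
-- (edges of M meet themselves, so only edges outside M matter)
isMaximalMatching : (G : Graph) → List (Edge (size G)) → Bool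
isMaximalMatching G M = isMatching M ∧ not (any (addable M) (edges G))

matchings : (G : Graph) → List (List (Edge (size G)))
matchings G = filter (λ M → Data.Bool._≟_ (isMatching M) true) (sublists (edges G))
  where import Data.Bool

maximalMatchings : (G : Graph) → List (List (Edge (size G)))
maximalMatchings G = filter (λ M → Data.Bool._≟_ (isMaximalMatching G M) true) (sublists (edges G))
  where import Data.Bool

ν : Graph → ℕ
ν G = foldr (λ M m → length M ⊔ m) 0 (matchings G)

𝒯₀ : Graph → ℕ
𝒯₀ G = length (maximalMatchings G)

𝒯₁ : Graph → ℕ
𝒯₁ G = sum (map length (maximalMatchings G))

-- ℐ(G) = 𝒯₁ / (ν 𝒯₀), and 1 if ν(G) = 0 (the denominator is 0 only then,
-- since 𝒯₀(G) ≥ 1 always)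
ratio : ℕ → ℕ → ℚ
ratio t zero = 1ℚ
ratio t (suc d) = (+ t) / suc d

ℐ : Graph → ℚ
ℐ G with ν G
... | zero = 1ℚ
... | suc k = ratio (𝒯₁ G) (suc k ℕ.* 𝒯₀ G)

-- corona G̃: add for each vertex v a new pendant vertex v' adjacent only to v.
-- Old vertex v ↦ v ↑ˡ n, new vertex v' ↦ n ↑ʳ v.
corona : Graph → Graph
corona (mkGraph n E) =
  mkGraph (n ℕ.+ n)
    (map (λ { (u , v) → (u ↑ˡ n , v ↑ˡ n) }) E
      ++ tabulate (λ v → (v ↑ˡ n , n ↑ʳ v)))

pathEdges : (n : ℕ) → List (Edge n)
pathEdges zero = []
pathEdges (suc zero) = []
pathEdges (suc (suc n)) = (zero , suc zero) ∷ map (λ { (u , v) → (suc u , suc v) }) (pathEdges (suc n))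

path : ℕ → Graph
path n = mkGraph n (pathEdges n)

cycle+3 : ℕ → Graph
cycle+3 k = mkGraph (3 ℕ.+ k) (pathEdges (3 ℕ.+ k) ++ ((fromℕ (2 ℕ.+ k) , zero) ∷ []))

-- Convergence vocabulary for rational sequences (no reals in the library).
-- a is Cauchy: the sequence converges (to a real number).
Cauchy : (ℕ → ℚ) → Set
Cauchy a = ∀ (ε : ℚ) → 0ℚ < ε → ∃ λ N → ∀ m n → N ≤ m → N ≤ n → ∣ a m - a n ∣ < ε

DiffToZero : (ℕ → ℚ) → (ℕ → ℚ) → Set
DiffToZero a b = ∀ (ε : ℚ) → 0ℚ < ε → ∃ λ N → ∀ n → N ≤ n → ∣ a n - b n ∣ < ε

-- lim a and lim b both exist and are equal
SameLimit : (ℕ → ℚ) → (ℕ → ℚ) → Set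
SameLimit a b = Cauchy a × Cauchy b × DiffToZero a b

module Submission where

-- A maximal matching of the corona G̃ of an n-vertex graph G is a matching M of G together
-- with the pendant edges at the vertices that M leaves uncovered, and the pendant edges alone
-- form a perfect matching. Hence ν(G̃) = n, 𝒯₀(G̃) = Z(G) and 𝒯₁(G̃) = n·Z(G) − S(G), where Z(G)
-- is the number of matchings of G and S(G) their total size. Splitting off the first edge of a
-- path, or the closing edge of a cycle, gives Fibonacci recurrences for Z and S, whence
-- ℐ(C̃ₖ₊₃) = F(k+4)/L(k+3) and ℐ(P̃ₖ₊₃) = 1 − S(Pₖ₊₃)/((k+3)·F(k+4)) with
-- 5·S(Pₖ₊₃) = (k+3)·L(k+3) − F(k+3). D'Ocagne's identity bounds |ℐ(C̃ₘ₊₃) − ℐ(C̃ₙ₊₃)| by 1/(m+1)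
-- and Cassini's identity bounds |ℐ(C̃ₙ₊₃) − ℐ(P̃ₙ₊₃)| by 1/(n+1).

open import Defs
open import Data.Bool using (Bool; true; false; _∧_; _∨_; not)
import Data.Bool as Bool
open import Data.Bool.ListAction using (all; any)
open import Data.Bool.Properties
  using (∧-assoc; ∧-commutativeMonoid; ∧-identityʳ; ∧-zeroʳ; ∨-assoc; ∨-identityʳ; ∨-inverseʳ; ∨-zeroʳ; not-injective)
open import Algebra.Solver.CommutativeMonoid ∧-commutativeMonoid using (_⊜_; _⊕_) renaming (solve to ∧-solve)
open import Data.Empty using (⊥-elim)
open import Data.Fin as Fin using (Fin; zero; suc; _↑ˡ_; _↑ʳ_; fromℕ; toℕ)
import Data.Fin.Properties as Finₚ
open import Data.List using (List; []; _∷_; map; _++_; length; filter; foldr; allFin; [_])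
import Data.List.Properties as Listₚ
open import Data.List.Membership.Propositional using (_∈_)
open import Data.List.Membership.Propositional.Properties using (∈-allFin; ∈-++⁺ˡ; ∈-++⁺ʳ; ∈-map⁺; ∈-filter⁺)
open import Data.List.Relation.Unary.All as All using (All; []; _∷_)
import Data.List.Relation.Unary.All.Properties as Allₚ
open import Data.List.Relation.Unary.AllPairs using ([]; _∷_)
open import Data.List.Relation.Unary.Any as Any using (Any; here; there)
open import Data.List.Relation.Unary.Unique.Propositional using (Unique)
open import Data.List.Relation.Unary.Unique.Propositional.Properties using (allFin⁺)
open import Data.Nat as ℕ using (ℕ; zero; suc; _+_; _*_; _∸_; _≤_; _⊔_; z≤n; s≤s)
open import Data.Nat.ListAction using (sum)
open import Data.Nat.Properties hiding (_≟_)
open import Data.Nat.Tactic.RingSolver using (solve-∀)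
open import Data.Integer as ℤ using (ℤ; -1ℤ)
import Data.Integer.Properties as ℤₚ
import Data.Integer.Tactic.RingSolver as ℤ-Solver
open import Data.Rational as ℚ using (ℚ)
open import Data.Product using (_×_; _,_; proj₁; proj₂; ∃)
open import Data.Sum using (_⊎_; inj₁; inj₂)
open import Function using (_∘_)
open import Function.Definitions using (Injective)
open import Relation.Binary.PropositionalEquality hiding ([_])
open import Relation.Nullary using (yes; no; ¬_)

private variable
  A B : Set
  m n : ℕ

sumBy : (A → ℕ) → List A → ℕ
sumBy f []       = 0
sumBy f (x ∷ xs) = f x + sumBy f xs

infix 5 _when_
_when_ : ℕ → Bool → ℕ
k when true  = k
k when false = 0

sumBy-++ : ∀ (f : A → ℕ) xs ys → sumBy f (xs ++ ys) ≡ sumBy f xs + sumBy f ys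
sumBy-++ f []       ys = refl
sumBy-++ f (x ∷ xs) ys = trans (cong (f x +_) (sumBy-++ f xs ys)) (sym (+-assoc (f x) _ _))

sumBy-map : ∀ (f : B → ℕ) (g : A → B) xs → sumBy f (map g xs) ≡ sumBy (f ∘ g) xs
sumBy-map f g []       = refl
sumBy-map f g (x ∷ xs) = cong (f (g x) +_) (sumBy-map f g xs)

sumBy-cong-All : ∀ {f g : A → ℕ} {xs} → All (λ x → f x ≡ g x) xs → sumBy f xs ≡ sumBy g xs
sumBy-cong-All []       = refl
sumBy-cong-All (e ∷ es) = cong₂ _+_ e (sumBy-cong-All es)

sumBy-cong : ∀ {f g : A → ℕ} → (∀ x → f x ≡ g x) → ∀ xs → sumBy f xs ≡ sumBy g xs
sumBy-cong f≗g xs = sumBy-cong-All {xs = xs} (All.tabulate (λ {x} _ → f≗g x))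

sumBy-zero : ∀ (xs : List A) → sumBy (λ _ → 0) xs ≡ 0
sumBy-zero []       = refl
sumBy-zero (x ∷ xs) = sumBy-zero xs

sumBy-+ : ∀ (f g : A → ℕ) xs → sumBy (λ x → f x + g x) xs ≡ sumBy f xs + sumBy g xs
sumBy-+ f g []       = refl
sumBy-+ f g (x ∷ xs) = trans (cong (f x + g x +_) (sumBy-+ f g xs)) (+-shuffle (f x) (g x) _ _)
  where
  +-shuffle : ∀ a b c d → a + b + (c + d) ≡ a + c + (b + d)
  +-shuffle = solve-∀

sumBy-*ˡ : ∀ k (f : A → ℕ) xs → sumBy (λ x → k * f x) xs ≡ k * sumBy f xs
sumBy-*ˡ k f []       = sym (*-zeroʳ k)
sumBy-*ˡ k f (x ∷ xs) = trans (cong (k * f x +_) (sumBy-*ˡ k f xs)) (sym (*-distribˡ-+ k (f x) _))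

filterᵇ : (A → Bool) → List A → List A
filterᵇ p = filter (λ x → p x Bool.≟ true)

length-filterᵇ : ∀ (p : A → Bool) xs → length (filterᵇ p xs) ≡ sumBy (λ x → 1 when p x) xs
length-filterᵇ p []       = refl
length-filterᵇ p (x ∷ xs) with p x
... | true  = cong suc (length-filterᵇ p xs)
... | false = length-filterᵇ p xs

sum-length-filterᵇ : ∀ (p : List A → Bool) xss →
  sum (map length (filterᵇ p xss)) ≡ sumBy (λ xs → length xs when p xs) xss
sum-length-filterᵇ p []         = refl
sum-length-filterᵇ p (xs ∷ xss) with p xs
... | true  = cong (length xs +_) (sum-length-filterᵇ p xss)
... | false = sum-length-filterᵇ p xss

sublists-map : ∀ (f : A → B) xs → sublists (map f xs) ≡ map (map f) (sublists xs)
sublists-map f []       = refl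
sublists-map f (x ∷ xs) rewrite sublists-map f xs =
  trans (cong (_++ _) (trans (sym (Listₚ.map-∘ (sublists xs))) (Listₚ.map-∘ (sublists xs))))
        (sym (Listₚ.map-++ (map f) (map (x ∷_) (sublists xs)) (sublists xs)))

sumBy-sublists-++ : ∀ (f : List A → ℕ) xs ys →
  sumBy f (sublists (xs ++ ys)) ≡ sumBy (λ s → sumBy (λ t → f (s ++ t)) (sublists ys)) (sublists xs)
sumBy-sublists-++ f []       ys = sym (+-identityʳ _)
sumBy-sublists-++ f (x ∷ xs) ys = begin
  sumBy f (map (x ∷_) r ++ r)                     ≡⟨ sumBy-++ f (map (x ∷_) r) r ⟩
  sumBy f (map (x ∷_) r) + sumBy f r               ≡⟨ cong (_+ sumBy f r) (sumBy-map f (x ∷_) r) ⟩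
  sumBy (f ∘ (x ∷_)) r + sumBy f r                 ≡⟨ cong₂ _+_ (sumBy-sublists-++ (f ∘ (x ∷_)) xs ys)
                                                                (sumBy-sublists-++ f xs ys) ⟩
  sumBy (g ∘ (x ∷_)) rx + sumBy g rx               ≡⟨ cong (_+ sumBy g rx) (sumBy-map g (x ∷_) rx) ⟨
  sumBy g (map (x ∷_) rx) + sumBy g rx             ≡⟨ sumBy-++ g (map (x ∷_) rx) rx ⟨
  sumBy g (map (x ∷_) rx ++ rx)                    ∎
  where
  open ≡-Reasoning
  r  = sublists (xs ++ ys)
  rx = sublists xs
  g  = λ s → sumBy (λ t → f (s ++ t)) (sublists ys)

sublists-All : ∀ {P : A → Set} {xs} → All P xs → All (All P) (sublists xs)
sublists-All []       = [] ∷ []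
sublists-All (p ∷ ps) = Allₚ.++⁺ (Allₚ.map⁺ (All.map (p ∷_) (sublists-All ps))) (sublists-All ps)

sublists-Unique : ∀ {xs : List A} → Unique xs → All Unique (sublists xs)
sublists-Unique []         = [] ∷ []
sublists-Unique (x∉ ∷ uxs) =
  Allₚ.++⁺ (Allₚ.map⁺ (All.zipWith (λ (a , b) → a ∷ b) (sublists-All x∉ , sublists-Unique uxs)))
           (sublists-Unique uxs)

∈-sublists-suffix : ∀ (xs ys : List A) → ys ∈ sublists (xs ++ ys)
∈-sublists-suffix []       []       = here refl
∈-sublists-suffix []       (y ∷ ys) = ∈-++⁺ˡ (∈-map⁺ (y ∷_) (∈-sublists-suffix [] ys))
∈-sublists-suffix (x ∷ xs) ys       = ∈-++⁺ʳ _ (∈-sublists-suffix xs ys)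

foldr-⊔-attained : ∀ (f : A → ℕ) k xs → All (λ x → f x ≤ k) xs → Any (λ x → f x ≡ k) xs →
  foldr (λ x m → f x ⊔ m) 0 xs ≡ k
foldr-⊔-attained f k xs bounded attained = ≤-antisym (upper bounded) (lower attained)
  where
  upper : ∀ {xs} → All (λ x → f x ≤ k) xs → foldr (λ x m → f x ⊔ m) 0 xs ≤ k
  upper []       = z≤n
  upper (b ∷ bs) = ⊔-lub b (upper bs)
  lower : ∀ {xs} → Any (λ x → f x ≡ k) xs → k ≤ foldr (λ x m → f x ⊔ m) 0 xs
  lower (here refl)  = m≤m⊔n _ _
  lower (there {x} a) = ≤-trans (lower a) (m≤n⊔m (f x) _)

∧-elim : ∀ {a b} → a ∧ b ≡ true → a ≡ true × b ≡ true
∧-elim {true} {true} _ = refl , refl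

∧-intro : ∀ {a b} → a ≡ true → b ≡ true → a ∧ b ≡ true
∧-intro refl refl = refl

true≢false : ¬ true ≡ false
true≢false ()

∨-elim : ∀ a {b} → a ∨ b ≡ true → a ≡ true ⊎ b ≡ true
∨-elim true  _ = inj₁ refl
∨-elim false h = inj₂ h

bool-ext : ∀ {a b} → (a ≡ true → b ≡ true) → (b ≡ true → a ≡ true) → a ≡ b
bool-ext {true}  {true}  _ _ = refl
bool-ext {true}  {false} f _ = sym (f refl)
bool-ext {false} {true}  _ g = g refl
bool-ext {false} {false} _ _ = refl

all⇒All : ∀ {p : A → Bool} xs → all p xs ≡ true → All (λ x → p x ≡ true) xs
all⇒All []       _  = []
all⇒All (x ∷ xs) px = let px , pxs = ∧-elim px in px ∷ all⇒All xs pxs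

All⇒all : ∀ {p : A → Bool} {xs} → All (λ x → p x ≡ true) xs → all p xs ≡ true
All⇒all []         = refl
All⇒all (px ∷ pxs) = ∧-intro px (All⇒all pxs)

any⇒Any : ∀ {p : A → Bool} xs → any p xs ≡ true → Any (λ x → p x ≡ true) xs
any⇒Any {p = p} (x ∷ xs) h with p x in px
... | true  = here px
... | false = there (any⇒Any xs h)

Any⇒any : ∀ {p : A → Bool} {xs} → Any (λ x → p x ≡ true) xs → any p xs ≡ true
Any⇒any (here px) rewrite px = refl
Any⇒any {p = p} (there {x} h) with p x
... | true  = refl
... | false = Any⇒any h

all-++ : ∀ (p : A → Bool) xs ys → all p (xs ++ ys) ≡ all p xs ∧ all p ys
all-++ p []       ys = refl
all-++ p (x ∷ xs) ys = trans (cong (p x ∧_) (all-++ p xs ys)) (sym (∧-assoc (p x) _ _))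

all-map : ∀ (p : B → Bool) (f : A → B) xs → all p (map f xs) ≡ all (p ∘ f) xs
all-map p f []       = refl
all-map p f (x ∷ xs) = cong (p (f x) ∧_) (all-map p f xs)

all-cong-All : ∀ {p q : A → Bool} {xs} → All (λ x → p x ≡ q x) xs → all p xs ≡ all q xs
all-cong-All []         = refl
all-cong-All (px ∷ pxs) = cong₂ _∧_ px (all-cong-All pxs)

all-cong : ∀ {p q : A → Bool} → (∀ x → p x ≡ q x) → ∀ xs → all p xs ≡ all q xs
all-cong p≗q xs = all-cong-All {xs = xs} (All.tabulate (λ {x} _ → p≗q x))

all-not≡not-any : ∀ (p : A → Bool) xs → all (not ∘ p) xs ≡ not (any p xs)
all-not≡not-any p []       = refl
all-not≡not-any p (x ∷ xs) with p x
... | true  = refl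
... | false = all-not≡not-any p xs

any-++ : ∀ (p : A → Bool) xs ys → any p (xs ++ ys) ≡ any p xs ∨ any p ys
any-++ p []       ys = refl
any-++ p (x ∷ xs) ys = trans (cong (p x ∨_) (any-++ p xs ys)) (sym (∨-assoc (p x) _ _))

=ᵥ⇒≡ : {u v : Fin n} → u =ᵥ v ≡ true → u ≡ v
=ᵥ⇒≡ {u = u} {v} h with u Fin.≟ v
... | yes u≡v = u≡v

=ᵥ-refl : (v : Fin n) → v =ᵥ v ≡ true
=ᵥ-refl v with v Fin.≟ v
... | yes _   = refl
... | no  v≢v = ⊥-elim (v≢v refl)

≢⇒=ᵥ-false : {u v : Fin n} → ¬ u ≡ v → u =ᵥ v ≡ false
≢⇒=ᵥ-false {u = u} {v} u≢v with u Fin.≟ v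
... | yes u≡v = ⊥-elim (u≢v u≡v)
... | no  _   = refl

=ᵥ-resp-⇔ : {u v : Fin n} {u′ v′ : Fin m} →
  (u ≡ v → u′ ≡ v′) → (u′ ≡ v′ → u ≡ v) → u =ᵥ v ≡ u′ =ᵥ v′
=ᵥ-resp-⇔ to from = bool-ext (λ h → subst (λ w → _ =ᵥ w ≡ true) (to (=ᵥ⇒≡ h)) (=ᵥ-refl _))
                             (λ h → subst (λ w → _ =ᵥ w ≡ true) (from (=ᵥ⇒≡ h)) (=ᵥ-refl _))

=ᵥ-sym : (u v : Fin n) → u =ᵥ v ≡ v =ᵥ u
=ᵥ-sym u v = =ᵥ-resp-⇔ sym sym

=ᵥ-injective : {f : Fin n → Fin m} → Injective _≡_ _≡_ f → ∀ u v → f u =ᵥ f v ≡ u =ᵥ v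
=ᵥ-injective {f = f} f-inj u v = =ᵥ-resp-⇔ f-inj (cong f)

covers : Fin n → Edge n → Bool
covers v (a , b) = (v =ᵥ a) ∨ (v =ᵥ b)

covered : List (Edge n) → Fin n → Bool
covered s v = any (covers v) s

Loopless : Edge n → Set
Loopless (a , b) = ¬ a ≡ b

mapEdge : (Fin n → Fin m) → Edge n → Edge m
mapEdge f (a , b) = (f a , f b)

covers-fst : (a b : Fin n) → covers a (a , b) ≡ true
covers-fst a b rewrite =ᵥ-refl a = refl

covers-snd : (a b : Fin n) → covers b (a , b) ≡ true
covers-snd a b rewrite =ᵥ-refl b = ∨-zeroʳ (b =ᵥ a)

covers⇒endpoint : ∀ {v a b : Fin n} → covers v (a , b) ≡ true → v ≡ a ⊎ v ≡ b
covers⇒endpoint {v = v} {a} h with v =ᵥ a in va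
... | true  = inj₁ (=ᵥ⇒≡ va)
... | false = inj₂ (=ᵥ⇒≡ h)

meets≡covers∨covers : (a b : Fin n) (f : Edge n) → meets (a , b) f ≡ covers a f ∨ covers b f
meets≡covers∨covers a b (c , d) = sym (∨-assoc (a =ᵥ c) (a =ᵥ d) _)

meets-sym : (e f : Edge n) → meets e f ≡ meets f e
meets-sym (a , b) (c , d)
  rewrite =ᵥ-sym a c | =ᵥ-sym a d | =ᵥ-sym b c | =ᵥ-sym b d = swap (c =ᵥ a) (d =ᵥ a) (c =ᵥ b) (d =ᵥ b)
  where
  swap : ∀ p q r s → p ∨ q ∨ r ∨ s ≡ p ∨ r ∨ q ∨ s
  swap true  _     _     _ = refl
  swap false true  true  _ = refl
  swap false true  false _ = refl
  swap false false _     _ = refl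

addable≡uncovered : (s : List (Edge n)) (a b : Fin n) →
  addable s (a , b) ≡ not (covered s a) ∧ not (covered s b)
addable≡uncovered []      a b = refl
addable≡uncovered (f ∷ s) a b rewrite meets≡covers∨covers a b f | addable≡uncovered s a b =
  shuffle (covers a f) (covers b f) (covered s a) (covered s b)
  where
  shuffle : ∀ x y X Y → not (x ∨ y) ∧ (not X ∧ not Y) ≡ not (x ∨ X) ∧ not (y ∨ Y)
  shuffle true  y     X Y = refl
  shuffle false true  X Y = sym (∧-zeroʳ (not X))
  shuffle false false X Y = refl

addable-++ : (xs ys : List (Edge n)) (e : Edge n) → addable (xs ++ ys) e ≡ addable xs e ∧ addable ys e
addable-++ xs ys e = all-++ _ xs ys

isMatching-++ : (xs ys : List (Edge n)) →
  isMatching (xs ++ ys) ≡ isMatching xs ∧ isMatching ys ∧ all (addable ys) xs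
isMatching-++ []       ys = sym (∧-identityʳ (isMatching ys))
isMatching-++ (x ∷ xs) ys rewrite addable-++ xs ys x | isMatching-++ xs ys =
  rearrange (addable xs x) (addable ys x) (isMatching xs) (isMatching ys) (all (addable ys) xs)
  where
  rearrange : ∀ a b c d e → (a ∧ b) ∧ (c ∧ d ∧ e) ≡ (a ∧ c) ∧ d ∧ (b ∧ e)
  rearrange = ∧-solve 5 (λ a b c d e → (a ⊕ b) ⊕ (c ⊕ d ⊕ e) ⊜ (a ⊕ c) ⊕ d ⊕ (b ⊕ e)) refl

isMatching-∷ʳ : (s : List (Edge n)) (x : Edge n) → isMatching (s ++ [ x ]) ≡ isMatching s ∧ addable s x
isMatching-∷ʳ s x rewrite isMatching-++ s [ x ] =
  cong (isMatching s ∧_) (all-cong (λ e → trans (∧-identityʳ _) (cong not (meets-sym e x))) s)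

isMatching-map : (g : Edge n → Edge m) → (∀ e f → meets (g e) (g f) ≡ meets e f) →
  ∀ s → isMatching (map g s) ≡ isMatching s
isMatching-map g g-meets []      = refl
isMatching-map g g-meets (e ∷ s) =
  cong₂ _∧_ (trans (all-map _ g s) (all-cong (λ f → cong not (g-meets e f)) s)) (isMatching-map g g-meets s)

uncovered-by-disjoint : (X s : List (Edge n)) (v : Fin n) →
  all (addable X) s ≡ true → covered s v ≡ true → covered X v ≡ false
uncovered-by-disjoint X ((a , b) ∷ s) v h vs with ∧-elim h | ∨-elim (covers v (a , b)) vs
... | _  , Xs | inj₂ vs′ = uncovered-by-disjoint X s v Xs vs′
... | Xa , _  | inj₁ ve
  with ∧-elim {not (covered X a)} (trans (sym (addable≡uncovered X a b)) Xa) | covers⇒endpoint {v = v} {a} {b} ve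
...   | a∉X , _ | inj₁ refl = not-injective a∉X
...   | _ , b∉X | inj₂ refl = not-injective b∉X

module _ {f : Fin n → Fin m} (f-injective : Injective _≡_ _≡_ f) where

  covers-mapEdge : ∀ v e → covers (f v) (mapEdge f e) ≡ covers v e
  covers-mapEdge v (a , b) = cong₂ _∨_ (=ᵥ-injective f-injective v a) (=ᵥ-injective f-injective v b)

  meets-mapEdge : ∀ e e′ → meets (mapEdge f e) (mapEdge f e′) ≡ meets e e′
  meets-mapEdge (a , b) e′
    rewrite meets≡covers∨covers (f a) (f b) (mapEdge f e′) | meets≡covers∨covers a b e′ =
    cong₂ _∨_ (covers-mapEdge a e′) (covers-mapEdge b e′)

  covered-mapEdge : ∀ s v → covered (map (mapEdge f) s) (f v) ≡ covered s v
  covered-mapEdge []      v = refl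
  covered-mapEdge (e ∷ s) v = cong₂ _∨_ (covers-mapEdge v e) (covered-mapEdge s v)

  mapEdge-Loopless : ∀ {e} → Loopless e → Loopless (mapEdge f e)
  mapEdge-Loopless {a , b} a≢b = a≢b ∘ f-injective

covered-outside-image : {f : Fin n → Fin m} {w : Fin m} → (∀ u → ¬ f u ≡ w) →
  ∀ s → covered (map (mapEdge f) s) w ≡ false
covered-outside-image w∉ []            = refl
covered-outside-image w∉ ((a , b) ∷ s)
  rewrite ≢⇒=ᵥ-false (w∉ a ∘ sym) | ≢⇒=ᵥ-false (w∉ b ∘ sym) = covered-outside-image w∉ s

covered-++ : (xs ys : List (Edge n)) (v : Fin n) → covered (xs ++ ys) v ≡ covered xs v ∨ covered ys v
covered-++ xs ys v = any-++ (covers v) xs ys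

∈⇒covered : ∀ {s : List (Edge n)} {e} v → e ∈ s → covers v e ≡ true → covered s v ≡ true
∈⇒covered {s = s} v e∈s ve =
  Any⇒any {p = covers v} {xs = s} (Any.map (λ e≡f → subst (λ f → covers v f ≡ true) e≡f ve) e∈s)

count : (Fin n → Bool) → ℕ
count {n} p = sumBy (λ v → 1 when p v) (allFin n)

count-suc : (p : Fin (suc n) → Bool) → count p ≡ (1 when p zero) + count (p ∘ suc)
count-suc {n} p =
  cong ((1 when p zero) +_) (trans (cong (sumBy _) (sym (Listₚ.map-tabulate {n = n} (λ i → i) suc)))
                                   (sumBy-map _ suc (allFin n)))

count-cong : {p q : Fin n → Bool} → (∀ v → p v ≡ q v) → count p ≡ count q
count-cong {n} p≗q = sumBy-cong (λ v → cong (1 when_) (p≗q v)) (allFin n)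

count-true : ∀ n → count {n} (λ _ → true) ≡ n
count-true zero    = refl
count-true (suc n) = trans (count-suc {n} (λ _ → true)) (cong suc (count-true n))

count-=ᵥ : (a : Fin n) → count (_=ᵥ a) ≡ 1
count-=ᵥ {suc n} zero    = trans (count-suc {n} (_=ᵥ zero))
  (cong₂ _+_ (cong (1 when_) (=ᵥ-refl {suc n} zero))
             (trans (count-cong {n} {q = λ _ → false} (λ v → ≢⇒=ᵥ-false {u = suc v} {zero} λ ()))
                    (sumBy-zero (allFin n))))
count-=ᵥ {suc n} (suc a) = trans (count-suc {n} (_=ᵥ suc a))
  (cong₂ _+_ (cong (1 when_) (≢⇒=ᵥ-false {u = zero} {suc a} λ ()))
             (trans (count-cong {n} (λ v → =ᵥ-injective Finₚ.suc-injective v a)) (count-=ᵥ a)))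

count-+ : (p q r : Fin n → Bool) → (∀ v → 1 when p v ≡ (1 when q v) + (1 when r v)) → count p ≡ count q + count r
count-+ {n} p q r split = trans (sumBy-cong split (allFin n)) (sumBy-+ _ _ (allFin n))

count-covers : (e : Edge n) → Loopless e → count (λ v → covers v e) ≡ 2
count-covers (a , b) a≢b =
  trans (count-+ _ (_=ᵥ a) (_=ᵥ b) split) (cong₂ _+_ (count-=ᵥ a) (count-=ᵥ b))
  where
  split : ∀ v → 1 when covers v (a , b) ≡ (1 when v =ᵥ a) + (1 when v =ᵥ b)
  split v with v =ᵥ a in va | v =ᵥ b in vb
  ... | true  | true  = ⊥-elim (a≢b (trans (sym (=ᵥ⇒≡ va)) (=ᵥ⇒≡ vb)))
  ... | true  | false = refl
  ... | false | true  = refl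
  ... | false | false = refl

-- Each edge of a matching covers two vertices that no other edge covers.
count-uncovered : (s : List (Edge n)) → All Loopless s → isMatching s ≡ true →
  count (not ∘ covered s) + 2 * length s ≡ n
count-uncovered {n} []      _          _ = trans (+-identityʳ _) (count-true n)
count-uncovered {n} (e ∷ s) (ℓe ∷ ℓs) m = begin
  count (not ∘ covered (e ∷ s)) + 2 * suc (length s)
    ≡⟨ rearrange (count (not ∘ covered (e ∷ s))) (length s) ⟩
  count (not ∘ covered (e ∷ s)) + 2 + 2 * length s
    ≡⟨ cong (λ k → count (not ∘ covered (e ∷ s)) + k + 2 * length s) (count-covers e ℓe) ⟨
  count (not ∘ covered (e ∷ s)) + count (λ v → covers v e) + 2 * length s
    ≡⟨ cong (_+ 2 * length s) (count-+ (not ∘ covered s) _ _ split) ⟨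
  count (not ∘ covered s) + 2 * length s
    ≡⟨ count-uncovered s ℓs e∷s-matching ⟩
  n ∎
  where
  open ≡-Reasoning
  rearrange : ∀ c l → c + 2 * suc l ≡ c + 2 + 2 * l
  rearrange = solve-∀
  e-disjoint = proj₁ (∧-elim m)
  e∷s-matching = proj₂ (∧-elim m)
  split : ∀ v → 1 when not (covered s v) ≡ (1 when not (covered (e ∷ s) v)) + (1 when covers v e)
  split v with covers v e in ve
  ... | true  rewrite uncovered-by-disjoint s [ e ] v (∧-intro e-disjoint refl) (trans (∨-identityʳ _) ve) = refl
  ... | false with covered s v
  ...   | true  = refl
  ...   | false = refl

_∈ᵥ_ : Fin n → List (Fin n) → Bool
v ∈ᵥ t = any (v =ᵥ_) t

∉⇒∈ᵥ-false : {v : Fin n} {t : List (Fin n)} → All (λ w → ¬ v ≡ w) t → v ∈ᵥ t ≡ false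
∉⇒∈ᵥ-false []          = refl
∉⇒∈ᵥ-false (v≢w ∷ v∉t) rewrite ≢⇒=ᵥ-false v≢w = ∉⇒∈ᵥ-false v∉t

infix 5 _⇔ᵇ_
_⇔ᵇ_ : Bool → Bool → Bool
true  ⇔ᵇ b = b
false ⇔ᵇ b = not b

⇔ᵇ⇒≡ : ∀ {a b} → a ⇔ᵇ b ≡ true → a ≡ b
⇔ᵇ⇒≡ {true}  {true}  _ = refl
⇔ᵇ⇒≡ {false} {false} _ = refl

≡⇒⇔ᵇ : ∀ {a b} → a ≡ b → a ⇔ᵇ b ≡ true
≡⇒⇔ᵇ {true}  refl = refl
≡⇒⇔ᵇ {false} refl = refl

selects : (Fin n → Bool) → List (Fin n) → List (Fin n) → Bool
selects p D t = all (λ v → v ∈ᵥ t ⇔ᵇ p v) D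

-- Exactly one sublist of a duplicate-free list selects a given predicate.
sumBy-selects : (p : Fin n → Bool) (h : ℕ → ℕ) {D : List (Fin n)} → Unique D →
  sumBy (λ t → h (length t) when selects p D t) (sublists D) ≡ h (sumBy (λ v → 1 when p v) D)
sumBy-selects p h {[]}    []         = +-identityʳ _
sumBy-selects p h {x ∷ D} (x∉D ∷ uD) = begin
  sumBy g (map (x ∷_) r ++ r)
    ≡⟨ sumBy-++ g (map (x ∷_) r) r ⟩
  sumBy g (map (x ∷_) r) + sumBy g r
    ≡⟨ cong₂ _+_ (trans (sumBy-map g (x ∷_) r) (sumBy-cong with-x r))
                 (sumBy-cong-All (All.map without-x (sublists-All x∉D))) ⟩
  sumBy (λ t → h (suc (length t)) when (p x ∧ selects p D t)) r
    + sumBy (λ t → h (length t) when (not (p x) ∧ selects p D t)) r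
    ≡⟨ by-cases (p x) ⟩
  h ((1 when p x) + sumBy (λ v → 1 when p v) D) ∎
  where
  open ≡-Reasoning
  r = sublists D
  g = λ t → h (length t) when selects p (x ∷ D) t
  with-x : ∀ t → g (x ∷ t) ≡ h (suc (length t)) when (p x ∧ selects p D t)
  with-x t rewrite =ᵥ-refl x = cong (λ b → h (suc (length t)) when (p x ∧ b))
    (all-cong-All (All.map (λ {v} x≢v → cong (λ b → (b ∨ v ∈ᵥ t) ⇔ᵇ p v) (≢⇒=ᵥ-false (x≢v ∘ sym))) x∉D))
  without-x : ∀ {t} → All (λ v → ¬ x ≡ v) t → g t ≡ h (length t) when (not (p x) ∧ selects p D t)
  without-x x∉t rewrite ∉⇒∈ᵥ-false x∉t = refl
  by-cases : ∀ b → sumBy (λ t → h (suc (length t)) when (b ∧ selects p D t)) r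
                 + sumBy (λ t → h (length t) when (not b ∧ selects p D t)) r
                 ≡ h ((1 when b) + sumBy (λ v → 1 when p v) D)
  by-cases true  = trans (cong₂ _+_ (sumBy-selects p (h ∘ suc) uD) (sumBy-zero r)) (+-identityʳ _)
  by-cases false = trans (cong (_+ sumBy (λ t → h (length t) when selects p D t) r) (sumBy-zero r)) (sumBy-selects p h uD)

matchingSum : (ℕ → ℕ) → List (Edge n) → ℕ
matchingSum h E = sumBy (λ s → h (length s) when isMatching s) (sublists E)

ℐ≡ratio : ∀ G {k} → ν G ≡ suc k → ℐ G ≡ ratio (𝒯₁ G) (suc k * 𝒯₀ G)
ℐ≡ratio G ν≡1+k with ν G
ℐ≡ratio G refl | .(suc _) = refl

module Corona (n : ℕ) (E : List (Edge n)) where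

  G̃ : Graph
  G̃ = corona (mkGraph n E)

  old new : Fin n → Fin (n + n)
  old v = v ↑ˡ n
  new v = n ↑ʳ v

  old-injective : Injective _≡_ _≡_ old
  old-injective = Finₚ.↑ˡ-injective n _ _

  old≢new : ∀ u v → ¬ old u ≡ new v
  old≢new u v eq = <⇒≢ (≤-trans (Finₚ.toℕ<n u) (m≤m+n n (toℕ v)))
    (trans (sym (Finₚ.toℕ-↑ˡ u n)) (trans (cong toℕ eq) (Finₚ.toℕ-↑ʳ n v)))

  lift : Edge n → Edge (n + n)
  lift = mapEdge old

  pendant : Fin n → Edge (n + n)
  pendant v = (old v , new v)

  edges-G̃ : edges G̃ ≡ map lift E ++ map pendant (allFin n)
  edges-G̃ = cong₂ _++_ (Listₚ.map-cong (λ { (a , b) → refl }) E) (sym (Listₚ.map-tabulate (λ i → i) pendant))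

  Loopless-G̃ : All Loopless E → All Loopless (edges G̃)
  Loopless-G̃ ℓE = subst (All Loopless) (sym edges-G̃)
    (Allₚ.++⁺ (Allₚ.map⁺ (All.map (mapEdge-Loopless old-injective) ℓE))
              (Allₚ.map⁺ (All.tabulate (λ {v} _ → old≢new v v))))

  covered-pendants-old : ∀ t v → covered (map pendant t) (old v) ≡ v ∈ᵥ t
  covered-pendants-old []      v = refl
  covered-pendants-old (w ∷ t) v
    rewrite =ᵥ-injective old-injective v w | ≢⇒=ᵥ-false (old≢new v w) | ∨-identityʳ (v =ᵥ w) =
    cong ((v =ᵥ w) ∨_) (covered-pendants-old t v)

  covered-pendants-new : ∀ t v → covered (map pendant t) (new v) ≡ v ∈ᵥ t
  covered-pendants-new []      v = refl
  covered-pendants-new (w ∷ t) v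
    rewrite ≢⇒=ᵥ-false (old≢new w v ∘ sym) | =ᵥ-injective (Finₚ.↑ʳ-injective n _ _) v w =
    cong ((v =ᵥ w) ∨_) (covered-pendants-new t v)

  isMatching-pendants : ∀ {t} → Unique t → isMatching (map pendant t) ≡ true
  isMatching-pendants {[]}    []         = refl
  isMatching-pendants {v ∷ t} (v∉t ∷ ut) = ∧-intro pendant-addable (isMatching-pendants ut)
    where
    pendant-addable : addable (map pendant t) (pendant v) ≡ true
    pendant-addable rewrite addable≡uncovered (map pendant t) (old v) (new v)
                          | covered-pendants-old t v | covered-pendants-new t v | ∉⇒∈ᵥ-false v∉t = refl

  module _ (s : List (Edge n)) (t : List (Fin n)) where

    private
      M = map lift s ++ map pendant t

    covered-old : ∀ v → covered M (old v) ≡ covered s v ∨ v ∈ᵥ t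
    covered-old v = trans (covered-++ (map lift s) (map pendant t) (old v))
                          (cong₂ _∨_ (covered-mapEdge old-injective s v) (covered-pendants-old t v))

    covered-new : ∀ v → covered M (new v) ≡ v ∈ᵥ t
    covered-new v = trans (covered-++ (map lift s) (map pendant t) (new v))
                          (cong₂ _∨_ (covered-outside-image (λ u → old≢new u v) s) (covered-pendants-new t v))

    isMatching-extension :
      isMatching M ≡ isMatching s ∧ isMatching (map pendant t) ∧ all (addable (map pendant t)) (map lift s)
    isMatching-extension = trans (isMatching-++ (map lift s) (map pendant t))
      (cong (_∧ isMatching (map pendant t) ∧ all (addable (map pendant t)) (map lift s))
            (isMatching-map lift (meets-mapEdge old-injective) s))

    addable-pendant : ∀ v → addable M (pendant v) ≡ not (covered s v ∨ v ∈ᵥ t) ∧ not (v ∈ᵥ t)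
    addable-pendant v = trans (addable≡uncovered M (old v) (new v))
                              (cong₂ (λ x y → not x ∧ not y) (covered-old v) (covered-new v))

    maximal⇒uncovered : isMaximalMatching G̃ M ≡ true →
      isMatching s ≡ true × (∀ v → v ∈ᵥ t ≡ not (covered s v))
    maximal⇒uncovered maximal = proj₁ (∧-elim M-matching) , uncovered
      where
      M-matching = trans (sym isMatching-extension) (proj₁ (∧-elim maximal))
      disjoint   = proj₂ (∧-elim (proj₂ (∧-elim {isMatching s} M-matching)))
      saturated : any (addable M) (edges G̃) ≡ false
      saturated = not-injective (proj₂ (∧-elim {isMatching M} maximal))
      pendant∈G̃ : ∀ v → pendant v ∈ edges G̃
      pendant∈G̃ v = subst (pendant v ∈_) (sym edges-G̃) (∈-++⁺ʳ (map lift E) (∈-map⁺ pendant (∈-allFin v)))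
      uncovered : ∀ v → v ∈ᵥ t ≡ not (covered s v)
      uncovered v with covered s v in vs | v ∈ᵥ t in vt
      ... | true  | false = refl
      ... | false | true  = refl
      ... | true  | true  = ⊥-elim (true≢false (trans (sym vt) (trans (sym (covered-pendants-old t v))
        (uncovered-by-disjoint (map pendant t) (map lift s) (old v) disjoint (trans (covered-mapEdge old-injective s v) vs)))))
      ... | false | false = ⊥-elim (true≢false (trans (sym (Any⇒any {xs = edges G̃} pendant-addable)) saturated))
        where
        pendant-addable : Any (λ e → addable M e ≡ true) (edges G̃)
        pendant-addable = Any.map (λ { refl → trans (addable-pendant v) (cong₂ (λ x y → not (x ∨ y) ∧ not y) vs vt) })
                                  (pendant∈G̃ v)

    uncovered⇒maximal : isMatching s ≡ true → Unique t → (∀ v → v ∈ᵥ t ≡ not (covered s v)) →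
      isMaximalMatching G̃ M ≡ true
    uncovered⇒maximal matching ut uncovered =
      ∧-intro (trans isMatching-extension (∧-intro matching (∧-intro (isMatching-pendants ut) disjoint)))
              (trans (sym (all-not≡not-any (addable M) (edges G̃))) nothing-addable)
      where
      covered-or-in : ∀ v → covered s v ∨ v ∈ᵥ t ≡ true
      covered-or-in v rewrite uncovered v = ∨-inverseʳ (covered s v)
      lift-blocked : ∀ e → addable M (lift e) ≡ false
      lift-blocked (a , b) rewrite addable≡uncovered M (old a) (old b) | covered-old a | covered-or-in a = refl
      pendant-blocked : ∀ v → addable M (pendant v) ≡ false
      pendant-blocked v rewrite addable-pendant v | covered-or-in v = refl
      nothing-addable : all (not ∘ addable M) (edges G̃) ≡ true
      nothing-addable = subst (λ es → all (not ∘ addable M) es ≡ true) (sym edges-G̃)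
        (All⇒all {xs = map lift E ++ map pendant (allFin n)}
          (Allₚ.++⁺ (Allₚ.map⁺ {f = lift} (All.tabulate {xs = E} λ {e} _ → cong not (lift-blocked e)))
                    (Allₚ.map⁺ {f = pendant} (All.tabulate {xs = allFin n} λ {v} _ → cong not (pendant-blocked v)))))
      endpoints-in-t : ∀ {e} → e ∈ s → addable (map pendant t) (lift e) ≡ true
      endpoints-in-t {a , b} e∈s
        rewrite addable≡uncovered (map pendant t) (old a) (old b)
              | covered-pendants-old t a | covered-pendants-old t b | uncovered a | uncovered b
              | ∈⇒covered a e∈s (covers-fst a b) | ∈⇒covered b e∈s (covers-snd a b) = refl
      disjoint : all (addable (map pendant t)) (map lift s) ≡ true
      disjoint = trans (all-map _ lift s) (All⇒all {xs = s} (All.tabulate {xs = s} endpoints-in-t))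

    isMaximal-extension : Unique t →
      isMaximalMatching G̃ M ≡ isMatching s ∧ selects (not ∘ covered s) (allFin n) t
    isMaximal-extension ut = bool-ext
      (λ maximal → let matching , uncovered = maximal⇒uncovered maximal in
        ∧-intro matching (All⇒all (All.tabulate {xs = allFin n} (λ {v} _ → ≡⇒⇔ᵇ (uncovered v)))))
      (λ h → let matching , selected = ∧-elim h in
        uncovered⇒maximal matching ut (λ v → ⇔ᵇ⇒≡ (All.lookup (all⇒All (allFin n) selected) (∈-allFin v))))

  sumBy-sublists-G̃ : (g : List (Edge (n + n)) → ℕ) → sumBy g (sublists (edges G̃)) ≡
    sumBy (λ s → sumBy (λ t → g (map lift s ++ map pendant t)) (sublists (allFin n))) (sublists E)
  sumBy-sublists-G̃ g = begin
    sumBy g (sublists (edges G̃))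
      ≡⟨ cong (sumBy g ∘ sublists) edges-G̃ ⟩
    sumBy g (sublists (map lift E ++ map pendant (allFin n)))
      ≡⟨ sumBy-sublists-++ g (map lift E) (map pendant (allFin n)) ⟩
    sumBy (λ s → sumBy (λ t → g (s ++ t)) (sublists (map pendant (allFin n)))) (sublists (map lift E))
      ≡⟨ cong (sumBy _) (sublists-map lift E) ⟩
    sumBy (λ s → sumBy (λ t → g (s ++ t)) (sublists (map pendant (allFin n)))) (map (map lift) (sublists E))
      ≡⟨ sumBy-map _ (map lift) (sublists E) ⟩
    sumBy (λ s → sumBy (λ t → g (map lift s ++ t)) (sublists (map pendant (allFin n)))) (sublists E)
      ≡⟨ sumBy-cong (λ s → trans (cong (sumBy _) (sublists-map pendant (allFin n)))
                                 (sumBy-map _ (map pendant) (sublists (allFin n)))) (sublists E) ⟩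
    sumBy (λ s → sumBy (λ t → g (map lift s ++ map pendant t)) (sublists (allFin n))) (sublists E) ∎
    where open ≡-Reasoning

  -- A matching of G extends to exactly one maximal matching of G̃: add the pendant
  -- edges at its uncovered vertices.
  sumBy-maximal-extensions : ∀ s (k : ℕ → ℕ) →
    sumBy (λ t → k (length t) when isMaximalMatching G̃ (map lift s ++ map pendant t)) (sublists (allFin n))
      ≡ k (count (not ∘ covered s)) when isMatching s
  sumBy-maximal-extensions s k =
    trans (sumBy-cong-All (All.map (λ {t} ut → cong (k (length t) when_) (isMaximal-extension s t ut))
                                   (sublists-Unique (allFin⁺ n))))
          (by-cases (isMatching s))
    where
    by-cases : ∀ b → sumBy (λ t → k (length t) when (b ∧ selects (not ∘ covered s) (allFin n) t)) (sublists (allFin n))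
                       ≡ k (count (not ∘ covered s)) when b
    by-cases true  = sumBy-selects (not ∘ covered s) k (allFin⁺ n)
    by-cases false = sumBy-zero (sublists (allFin n))

  𝒯₀-G̃ : 𝒯₀ G̃ ≡ matchingSum (λ _ → 1) E
  𝒯₀-G̃ = trans (length-filterᵇ (isMaximalMatching G̃) (sublists (edges G̃)))
         (trans (sumBy-sublists-G̃ _) (sumBy-cong (λ s → sumBy-maximal-extensions s (λ _ → 1)) (sublists E)))

  𝒯₁-G̃ : All Loopless E → 𝒯₁ G̃ + matchingSum (λ l → l) E ≡ n * matchingSum (λ _ → 1) E
  𝒯₁-G̃ ℓE = begin
    𝒯₁ G̃ + matchingSum (λ l → l) E
      ≡⟨ cong (_+ matchingSum (λ l → l) E) sizes ⟩
    sumBy (λ s → (length s + count (not ∘ covered s)) when isMatching s) (sublists E) + matchingSum (λ l → l) E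
      ≡⟨ sumBy-+ _ _ (sublists E) ⟨
    sumBy (λ s → ((length s + count (not ∘ covered s)) when isMatching s) + (length s when isMatching s)) (sublists E)
      ≡⟨ sumBy-cong-All (All.map (λ {s} → each-matching s) (sublists-All ℓE)) ⟩
    sumBy (λ s → n * (1 when isMatching s)) (sublists E)
      ≡⟨ sumBy-*ˡ n _ (sublists E) ⟩
    n * matchingSum (λ _ → 1) E ∎
    where
    open ≡-Reasoning
    length-extension : ∀ s t → length (map lift s ++ map pendant t) ≡ length s + length t
    length-extension s t =
      trans (Listₚ.length-++ (map lift s)) (cong₂ _+_ (Listₚ.length-map lift s) (Listₚ.length-map pendant t))
    sizes : 𝒯₁ G̃ ≡ sumBy (λ s → (length s + count (not ∘ covered s)) when isMatching s) (sublists E)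
    sizes = trans (sum-length-filterᵇ (isMaximalMatching G̃) (sublists (edges G̃)))
      (trans (sumBy-sublists-G̃ _) (sumBy-cong (λ s → trans (sumBy-cong (split-length s) (sublists (allFin n)))
                                                          (sumBy-maximal-extensions s (length s +_))) (sublists E)))
      where
      split-length : ∀ s t → let M = map lift s ++ map pendant t in
        length M when isMaximalMatching G̃ M ≡ (length s + length t) when isMaximalMatching G̃ M
      split-length s t = cong (_when isMaximalMatching G̃ (map lift s ++ map pendant t)) (length-extension s t)
    each-matching : ∀ s → All Loopless s →
      ((length s + count (not ∘ covered s)) when isMatching s) + (length s when isMatching s)
        ≡ n * (1 when isMatching s)
    each-matching s ℓs with isMatching s in matching
    ... | false = sym (*-zeroʳ n)
    ... | true  = trans (rearrange (length s) (count (not ∘ covered s)))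
                        (trans (count-uncovered s ℓs matching) (sym (*-identityʳ n)))
      where
      rearrange : ∀ l c → l + c + l ≡ c + 2 * l
      rearrange = solve-∀

  ν-G̃ : All Loopless E → ν G̃ ≡ n
  ν-G̃ ℓE = foldr-⊔-attained length n (matchings G̃)
    (All.zipWith (λ (matching , ℓM) → size≤n ℓM matching)
                 (Allₚ.all-filter is-matching? (sublists (edges G̃)) ,
                  Allₚ.filter⁺ is-matching? (sublists-All (Loopless-G̃ ℓE))))
    (Any.map (λ { refl → trans (Listₚ.length-map pendant (allFin n)) (Listₚ.length-tabulate (λ i → i)) })
             (∈-filter⁺ is-matching? pendants∈ (isMatching-pendants (allFin⁺ n))))
    where
    is-matching? = λ M → isMatching M Bool.≟ true
    size≤n : ∀ {M} → All Loopless M → isMatching M ≡ true → length M ≤ n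
    size≤n {M} ℓM matching = *-cancelˡ-≤ 2 (begin
      2 * length M                                  ≤⟨ m≤n+m _ (count (not ∘ covered M)) ⟩
      count (not ∘ covered M) + 2 * length M        ≡⟨ count-uncovered M ℓM matching ⟩
      n + n                                         ≡⟨ cong (n +_) (+-identityʳ n) ⟨
      2 * n                                         ∎)
      where open ≤-Reasoning
    pendants∈ : map pendant (allFin n) ∈ sublists (edges G̃)
    pendants∈ = subst (λ es → map pendant (allFin n) ∈ sublists es) (sym edges-G̃)
                      (∈-sublists-suffix (map lift E) (map pendant (allFin n)))

shift : Edge n → Edge (suc n)
shift = mapEdge suc

firstEdge : Edge (suc (suc n))
firstEdge = (zero , suc zero)

pathEdges-suc-suc : ∀ m → pathEdges (suc (suc m)) ≡ firstEdge ∷ map shift (pathEdges (suc m))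
pathEdges-suc-suc m = cong (firstEdge ∷_) (Listₚ.map-cong (λ { (a , b) → refl }) (pathEdges (suc m)))

Loopless-path : ∀ m → All Loopless (pathEdges m)
Loopless-path zero          = []
Loopless-path (suc zero)    = []
Loopless-path (suc (suc m)) = subst (All Loopless) (sym (pathEdges-suc-suc m))
  ((λ ()) ∷ Allₚ.map⁺ (All.map (mapEdge-Loopless Finₚ.suc-injective) (Loopless-path (suc m))))

isMatching-shift : (s : List (Edge n)) → isMatching (map shift s) ≡ isMatching s
isMatching-shift = isMatching-map shift (meets-mapEdge Finₚ.suc-injective)

isMatching-firstEdge : (s : List (Edge (suc n))) →
  isMatching (firstEdge ∷ map shift s) ≡ not (covered s zero) ∧ isMatching s
isMatching-firstEdge s = cong₂ _∧_
  (trans (addable≡uncovered (map shift s) zero (suc zero))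
         (cong₂ (λ x y → not x ∧ not y) (covered-outside-image {f = suc} {w = zero} (λ u ()) s)
                                        (covered-mapEdge Finₚ.suc-injective s zero)))
  (isMatching-shift s)

lastFree : Bool → (m : ℕ) → List (Edge (suc m)) → Bool
lastFree false m s = true
lastFree true  m s = not (covered s (fromℕ m))

lastFree-shift : ∀ b m (s : List (Edge (suc m))) → lastFree b (suc m) (map shift s) ≡ lastFree b m s
lastFree-shift false m s = refl
lastFree-shift true  m s = cong not (covered-mapEdge Finₚ.suc-injective s (fromℕ m))

lastFree-firstEdge : ∀ b m (s : List (Edge (suc (suc m)))) →
  lastFree b (suc (suc m)) (firstEdge ∷ map shift s) ≡ lastFree b (suc m) s
lastFree-firstEdge false m s = refl
lastFree-firstEdge true  m s = cong not (covered-mapEdge Finₚ.suc-injective s (fromℕ (suc m)))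

pathWeight : Bool → (m : ℕ) → (ℕ → ℕ) → List (Edge (suc m)) → ℕ
pathWeight b m h s = h (length s) when (isMatching s ∧ lastFree b m s)

-- Matchings of the path on m+1 vertices (leaving the last vertex free when b = true),
-- each weighted by h of its size.
pathSum : Bool → ℕ → (ℕ → ℕ) → ℕ
pathSum b m h = sumBy (pathWeight b m h) (sublists (pathEdges (suc m)))

pathWeight-shift : ∀ b m h (s : List (Edge (suc m))) → pathWeight b (suc m) h (map shift s) ≡ pathWeight b m h s
pathWeight-shift b m h s =
  cong₂ _when_ (cong h (Listₚ.length-map shift s)) (cong₂ _∧_ (isMatching-shift s) (lastFree-shift b m s))

pathWeight-firstEdge : ∀ b m h (s : List (Edge (suc (suc m)))) →
  pathWeight b (suc (suc m)) h (firstEdge ∷ map shift s)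
    ≡ h (suc (length s)) when (not (covered s zero) ∧ isMatching s ∧ lastFree b (suc m) s)
pathWeight-firstEdge b m h s = cong₂ _when_ (cong (h ∘ suc) (Listₚ.length-map shift s))
  (trans (cong₂ _∧_ (isMatching-firstEdge s) (lastFree-firstEdge b m s)) (∧-assoc (not (covered s zero)) _ _))

sumBy-sublists-path : ∀ m (g : List (Edge (suc (suc m))) → ℕ) →
  sumBy g (sublists (pathEdges (suc (suc m))))
    ≡ sumBy (λ s → g (firstEdge ∷ map shift s)) (sublists (pathEdges (suc m)))
      + sumBy (g ∘ map shift) (sublists (pathEdges (suc m)))
sumBy-sublists-path m g = begin
  sumBy g (sublists (pathEdges (suc (suc m))))
    ≡⟨ cong (sumBy g ∘ sublists) (pathEdges-suc-suc m) ⟩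
  sumBy g (map (firstEdge ∷_) r ++ r)
    ≡⟨ sumBy-++ g (map (firstEdge ∷_) r) r ⟩
  sumBy g (map (firstEdge ∷_) r) + sumBy g r
    ≡⟨ cong₂ _+_ (sumBy-map g (firstEdge ∷_) r) refl ⟩
  sumBy (g ∘ (firstEdge ∷_)) r + sumBy g r
    ≡⟨ cong₂ (λ x y → sumBy (g ∘ (firstEdge ∷_)) x + sumBy g y) rs rs ⟩
  sumBy (g ∘ (firstEdge ∷_)) (map (map shift) r′) + sumBy g (map (map shift) r′)
    ≡⟨ cong₂ _+_ (sumBy-map _ (map shift) r′) (sumBy-map g (map shift) r′) ⟩
  sumBy (λ s → g (firstEdge ∷ map shift s)) r′ + sumBy (g ∘ map shift) r′ ∎
  where
  open ≡-Reasoning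
  r  = sublists (map shift (pathEdges (suc m)))
  r′ = sublists (pathEdges (suc m))
  rs = sublists-map shift (pathEdges (suc m))

sumBy-avoiding-first : ∀ b m h →
  sumBy (λ s → h (length s) when (not (covered s zero) ∧ isMatching s ∧ lastFree b (suc m) s))
        (sublists (pathEdges (suc (suc m))))
    ≡ pathSum b m h
sumBy-avoiding-first b m h = begin
  sumBy g (sublists (pathEdges (suc (suc m))))
    ≡⟨ sumBy-sublists-path m g ⟩
  sumBy (λ s → g (firstEdge ∷ map shift s)) r + sumBy (g ∘ map shift) r
    ≡⟨ cong₂ _+_ (sumBy-zero r) (sumBy-cong g-shift r) ⟩
  sumBy (pathWeight b m h) r ∎
  where
  open ≡-Reasoning
  r = sublists (pathEdges (suc m))
  g = λ s → h (length s) when (not (covered s zero) ∧ isMatching s ∧ lastFree b (suc m) s)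
  g-shift : ∀ s → g (map shift s) ≡ pathWeight b m h s
  g-shift s rewrite covered-outside-image {f = suc} {w = zero} (λ u ()) s = pathWeight-shift b m h s

pathSum-recurrence : ∀ b m h → pathSum b (suc (suc m)) h ≡ pathSum b m (h ∘ suc) + pathSum b (suc m) h
pathSum-recurrence b m h = trans (sumBy-sublists-path (suc m) (pathWeight b (suc (suc m)) h))
  (cong₂ _+_ (trans (sumBy-cong (pathWeight-firstEdge b m h) (sublists (pathEdges (suc (suc m)))))
                    (sumBy-avoiding-first b m (h ∘ suc)))
             (sumBy-cong (pathWeight-shift b (suc m) h) (sublists (pathEdges (suc (suc m))))))

matchingSum-path : ∀ k h → matchingSum h (pathEdges (3 + k)) ≡ pathSum false (2 + k) h
matchingSum-path k h =
  sumBy-cong (λ s → cong (h (length s) when_) (sym (∧-identityʳ (isMatching s)))) (sublists (pathEdges (3 + k)))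

-- A matching of the cycle either avoids the closing edge {k+2, 0}, and is then a matching
-- of the path, or contains it, and is then a matching of the path leaving 0 and k+2 free.
matchingSum-cycle : ∀ k h → matchingSum h (edges (cycle+3 k)) ≡ pathSum false (2 + k) h + pathSum true (1 + k) (h ∘ suc)
matchingSum-cycle k h = begin
  sumBy g (sublists (P ++ [ x ]))
    ≡⟨ sumBy-sublists-++ g P [ x ] ⟩
  sumBy (λ s → g (s ++ [ x ]) + (g (s ++ []) + 0)) (sublists P)
    ≡⟨ sumBy-cong (λ s → cong (g (s ++ [ x ]) +_) (trans (+-identityʳ _) (cong g (Listₚ.++-identityʳ s)))) (sublists P) ⟩
  sumBy (λ s → g (s ++ [ x ]) + g s) (sublists P)
    ≡⟨ sumBy-+ (g ∘ (_++ [ x ])) g (sublists P) ⟩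
  sumBy (g ∘ (_++ [ x ])) (sublists P) + sumBy g (sublists P)
    ≡⟨ +-comm (sumBy (g ∘ (_++ [ x ])) (sublists P)) _ ⟩
  sumBy g (sublists P) + sumBy (g ∘ (_++ [ x ])) (sublists P)
    ≡⟨ cong₂ _+_ (matchingSum-path k h)
                 (trans (sumBy-cong with-x (sublists P)) (sumBy-avoiding-first true (suc k) (h ∘ suc))) ⟩
  pathSum false (2 + k) h + pathSum true (1 + k) (h ∘ suc) ∎
  where
  open ≡-Reasoning
  P = pathEdges (3 + k)
  x : Edge (3 + k)
  x = (fromℕ (2 + k) , zero)
  g = λ (s : List (Edge (3 + k))) → h (length s) when isMatching s
  rearrange : ∀ a b c → a ∧ (b ∧ c) ≡ c ∧ a ∧ b
  rearrange = ∧-solve 3 (λ a b c → a ⊕ (b ⊕ c) ⊜ c ⊕ a ⊕ b) refl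
  with-x : ∀ s → g (s ++ [ x ]) ≡ h (suc (length s)) when (not (covered s zero) ∧ isMatching s ∧ lastFree true (2 + k) s)
  with-x s = cong₂ _when_ (cong h (trans (Listₚ.length-++ s) (+-comm (length s) 1)))
    (trans (isMatching-∷ʳ s x) (trans (cong (isMatching s ∧_) (addable≡uncovered s (fromℕ (2 + k)) zero))
                                      (rearrange (isMatching s) (not (covered s (fromℕ (2 + k)))) (not (covered s zero)))))

Loopless-cycle : ∀ k → All Loopless (edges (cycle+3 k))
Loopless-cycle k = Allₚ.++⁺ (Loopless-path (3 + k)) ((λ ()) ∷ [])

fib : ℕ → ℕ
fib 0             = 0
fib 1             = 1
fib (suc (suc n)) = fib (suc n) + fib n

lucas : ℕ → ℕ
lucas zero    = 2
lucas (suc n) = fib n + fib (suc (suc n))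

matchingCount-path : ∀ m → pathSum false m (λ _ → 1) ≡ fib (2 + m)
matchingCount-path 0             = refl
matchingCount-path 1             = refl
matchingCount-path (suc (suc m)) = trans (pathSum-recurrence false m (λ _ → 1))
  (trans (cong₂ _+_ (matchingCount-path m) (matchingCount-path (suc m))) (+-comm (fib (2 + m)) _))

matchingCount-path-lastFree : ∀ m → pathSum true m (λ _ → 1) ≡ fib (1 + m)
matchingCount-path-lastFree 0             = refl
matchingCount-path-lastFree 1             = refl
matchingCount-path-lastFree (suc (suc m)) = trans (pathSum-recurrence true m (λ _ → 1))
  (trans (cong₂ _+_ (matchingCount-path-lastFree m) (matchingCount-path-lastFree (suc m))) (+-comm (fib (1 + m)) _))

pathSum-suc : ∀ b m → pathSum b m suc ≡ pathSum b m (λ l → l) + pathSum b m (λ _ → 1)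
pathSum-suc b m = trans (sumBy-cong (λ s → split (isMatching s ∧ lastFree b m s) (length s)) (sublists (pathEdges (suc m))))
                        (sumBy-+ _ _ (sublists (pathEdges (suc m))))
  where
  split : ∀ c l → suc l when c ≡ (l when c) + (1 when c)
  split true  l = +-comm 1 l
  split false l = refl

sizeSum-path sizeSum-path-lastFree : ℕ → ℕ
sizeSum-path          m = pathSum false m (λ l → l)
sizeSum-path-lastFree m = pathSum true  m (λ l → l)

sizeSum-path-recurrence : ∀ m → sizeSum-path (2 + m) ≡ sizeSum-path m + fib (2 + m) + sizeSum-path (1 + m)
sizeSum-path-recurrence m = trans (pathSum-recurrence false m (λ l → l))
  (cong (_+ sizeSum-path (1 + m)) (trans (pathSum-suc false m) (cong (sizeSum-path m +_) (matchingCount-path m))))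

sizeSum-path-lastFree≡sizeSum-path : ∀ m → sizeSum-path-lastFree (1 + m) ≡ sizeSum-path m
sizeSum-path-lastFree≡sizeSum-path 0             = refl
sizeSum-path-lastFree≡sizeSum-path 1             = refl
sizeSum-path-lastFree≡sizeSum-path (suc (suc m)) = begin
  sizeSum-path-lastFree (3 + m)
    ≡⟨ pathSum-recurrence true (1 + m) (λ l → l) ⟩
  pathSum true (1 + m) suc + sizeSum-path-lastFree (2 + m)
    ≡⟨ cong (_+ sizeSum-path-lastFree (2 + m)) (pathSum-suc true (1 + m)) ⟩
  sizeSum-path-lastFree (1 + m) + pathSum true (1 + m) (λ _ → 1) + sizeSum-path-lastFree (2 + m)
    ≡⟨ cong₂ (λ x y → x + y + sizeSum-path-lastFree (2 + m))
             (sizeSum-path-lastFree≡sizeSum-path m) (matchingCount-path-lastFree (1 + m)) ⟩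
  sizeSum-path m + fib (2 + m) + sizeSum-path-lastFree (2 + m)
    ≡⟨ cong (sizeSum-path m + fib (2 + m) +_) (sizeSum-path-lastFree≡sizeSum-path (suc m)) ⟩
  sizeSum-path m + fib (2 + m) + sizeSum-path (1 + m)
    ≡⟨ sizeSum-path-recurrence m ⟨
  sizeSum-path (2 + m) ∎
  where open ≡-Reasoning

sizeSum-path-closed : ∀ i → 5 * sizeSum-path i + fib (1 + i) ≡ (1 + i) * lucas (1 + i)
sizeSum-path-closed 0             = refl
sizeSum-path-closed 1             = refl
sizeSum-path-closed (suc (suc i)) = begin
  5 * sizeSum-path (2 + i) + fib (3 + i)
    ≡⟨ cong (λ z → 5 * z + fib (3 + i)) (sizeSum-path-recurrence i) ⟩
  5 * (sizeSum-path i + (y + x) + sizeSum-path (1 + i)) + ((y + x) + y)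
    ≡⟨ regroup (sizeSum-path i) (sizeSum-path (1 + i)) x y ⟩
  (5 * sizeSum-path i + y) + (5 * sizeSum-path (1 + i) + (y + x)) + 5 * (y + x)
    ≡⟨ cong₂ (λ p q → p + q + 5 * (y + x)) (sizeSum-path-closed i) (sizeSum-path-closed (suc i)) ⟩
  (1 + i) * (x + (y + x)) + (2 + i) * (y + ((y + x) + y)) + 5 * (y + x)
    ≡⟨ collect x y i ⟩
  (3 + i) * ((y + x) + (((y + x) + y) + (y + x))) ∎
  where
  open ≡-Reasoning
  x = fib i
  y = fib (1 + i)
  regroup : ∀ a b x y → 5 * (a + (y + x) + b) + ((y + x) + y) ≡ (5 * a + y) + (5 * b + (y + x)) + 5 * (y + x)
  regroup = solve-∀
  collect : ∀ x y i → (1 + i) * (x + (y + x)) + (2 + i) * (y + ((y + x) + y)) + 5 * (y + x)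
                      ≡ (3 + i) * ((y + x) + (((y + x) + y) + (y + x)))
  collect = solve-∀

sizeSum-cycle-closed : ∀ k → sizeSum-path (2 + k) + sizeSum-path k + fib (2 + k) ≡ (3 + k) * fib (2 + k)
sizeSum-cycle-closed k = *-cancelˡ-≡ _ _ 5 (+-cancelʳ-≡ (fib (3 + k) + fib (1 + k)) _ _ (begin
  5 * (sizeSum-path (2 + k) + sizeSum-path k + (y + x)) + (((y + x) + y) + y)
    ≡⟨ regroup (sizeSum-path (2 + k)) (sizeSum-path k) x y ⟩
  (5 * sizeSum-path (2 + k) + ((y + x) + y)) + (5 * sizeSum-path k + y) + 5 * (y + x)
    ≡⟨ cong₂ (λ p q → p + q + 5 * (y + x)) (sizeSum-path-closed (2 + k)) (sizeSum-path-closed k) ⟩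
  (3 + k) * ((y + x) + (((y + x) + y) + (y + x))) + (1 + k) * (x + (y + x)) + 5 * (y + x)
    ≡⟨ collect x y k ⟩
  5 * ((3 + k) * (y + x)) + (((y + x) + y) + y) ∎))
  where
  open ≡-Reasoning
  x = fib k
  y = fib (1 + k)
  regroup : ∀ a b x y → 5 * (a + b + (y + x)) + (((y + x) + y) + y) ≡ (5 * a + ((y + x) + y)) + (5 * b + y) + 5 * (y + x)
  regroup = solve-∀
  collect : ∀ x y k → (3 + k) * ((y + x) + (((y + x) + y) + (y + x))) + (1 + k) * (x + (y + x)) + 5 * (y + x)
                      ≡ 5 * ((3 + k) * (y + x)) + (((y + x) + y) + y)
  collect = solve-∀



module _ (k : ℕ) where
  private
    module C = Corona (3 + k) (edges (cycle+3 k))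
    module P = Corona (3 + k) (pathEdges (3 + k))

  ν-cycle : ν (corona (cycle+3 k)) ≡ 3 + k
  ν-cycle = C.ν-G̃ (Loopless-cycle k)

  ν-path : ν (corona (path (3 + k))) ≡ 3 + k
  ν-path = P.ν-G̃ (Loopless-path (3 + k))

  𝒯₀-cycle : 𝒯₀ (corona (cycle+3 k)) ≡ lucas (3 + k)
  𝒯₀-cycle = trans C.𝒯₀-G̃ (trans (matchingSum-cycle k (λ _ → 1))
    (trans (cong₂ _+_ (matchingCount-path (2 + k)) (matchingCount-path-lastFree (1 + k))) (+-comm (fib (4 + k)) _)))

  𝒯₁-cycle : 𝒯₁ (corona (cycle+3 k)) ≡ (3 + k) * fib (4 + k)
  𝒯₁-cycle = +-cancelʳ-≡ ((3 + k) * fib (2 + k)) _ _ (begin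
    𝒯₁ C.G̃ + (3 + k) * fib (2 + k)                    ≡⟨ cong (𝒯₁ C.G̃ +_) sizes ⟨
    𝒯₁ C.G̃ + matchingSum (λ l → l) (edges (cycle+3 k)) ≡⟨ C.𝒯₁-G̃ (Loopless-cycle k) ⟩
    (3 + k) * matchingSum (λ _ → 1) (edges (cycle+3 k)) ≡⟨ cong ((3 + k) *_) (trans (sym C.𝒯₀-G̃) 𝒯₀-cycle) ⟩
    (3 + k) * (fib (2 + k) + fib (4 + k))              ≡⟨ cong ((3 + k) *_) (+-comm (fib (2 + k)) _) ⟩
    (3 + k) * (fib (4 + k) + fib (2 + k))              ≡⟨ *-distribˡ-+ (3 + k) (fib (4 + k)) _ ⟩
    (3 + k) * fib (4 + k) + (3 + k) * fib (2 + k)      ∎)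
    where
    open ≡-Reasoning
    sizes : matchingSum (λ l → l) (edges (cycle+3 k)) ≡ (3 + k) * fib (2 + k)
    sizes = begin
      matchingSum (λ l → l) (edges (cycle+3 k))
        ≡⟨ matchingSum-cycle k (λ l → l) ⟩
      sizeSum-path (2 + k) + pathSum true (1 + k) suc
        ≡⟨ cong (sizeSum-path (2 + k) +_) (pathSum-suc true (1 + k)) ⟩
      sizeSum-path (2 + k) + (sizeSum-path-lastFree (1 + k) + pathSum true (1 + k) (λ _ → 1))
        ≡⟨ cong₂ (λ x y → sizeSum-path (2 + k) + (x + y))
                 (sizeSum-path-lastFree≡sizeSum-path k) (matchingCount-path-lastFree (1 + k)) ⟩
      sizeSum-path (2 + k) + (sizeSum-path k + fib (2 + k))
        ≡⟨ +-assoc (sizeSum-path (2 + k)) _ _ ⟨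
      sizeSum-path (2 + k) + sizeSum-path k + fib (2 + k)
        ≡⟨ sizeSum-cycle-closed k ⟩
      (3 + k) * fib (2 + k) ∎

  𝒯₀-path : 𝒯₀ (corona (path (3 + k))) ≡ fib (4 + k)
  𝒯₀-path = trans P.𝒯₀-G̃ (trans (matchingSum-path k (λ _ → 1)) (matchingCount-path (2 + k)))

  𝒯₁-path : 𝒯₁ (corona (path (3 + k))) + sizeSum-path (2 + k) ≡ (3 + k) * fib (4 + k)
  𝒯₁-path = trans (cong (𝒯₁ P.G̃ +_) (sym (matchingSum-path k (λ l → l))))
                  (trans (P.𝒯₁-G̃ (Loopless-path (3 + k)))
                         (cong ((3 + k) *_) (trans (matchingSum-path k (λ _ → 1)) (matchingCount-path (2 + k)))))

fib-positive : ∀ n → 1 ≤ fib (suc n)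
fib-positive 0       = s≤s z≤n
fib-positive (suc n) = ≤-trans (fib-positive n) (m≤m+n _ _)

fib-monotone : ∀ {m n} → m ≤ n → fib m ≤ fib n
fib-monotone {m} {n} m≤n = subst (λ k → fib m ≤ fib k) (m∸n+n≡m m≤n) (steps (n ∸ m))
  where
  step : ∀ k → fib k ≤ fib (suc k)
  step 0       = z≤n
  step (suc k) = m≤m+n _ _
  steps : ∀ d → fib m ≤ fib (d + m)
  steps zero    = ≤-refl
  steps (suc d) = ≤-trans (steps d) (step (d + m))

fib-≥ : ∀ n → suc n ≤ fib (2 + n)
fib-≥ 0             = s≤s z≤n
fib-≥ 1             = s≤s (s≤s z≤n)
fib-≥ (suc (suc n)) = subst (_≤ fib (4 + n)) (+-comm (2 + n) 1) (+-mono-≤ (fib-≥ (suc n)) (fib-positive (suc n)))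

fib≤lucas : ∀ n → fib (2 + n) ≤ lucas (1 + n)
fib≤lucas n = m≤n+m (fib (2 + n)) (fib n)

fib-nonZero : ∀ n → ℕ.NonZero (fib (suc n))
fib-nonZero n = ℕ.>-nonZero (fib-positive n)

lucas-nonZero : ∀ n → ℕ.NonZero (lucas (suc n))
lucas-nonZero n = ℕ.>-nonZero (≤-trans (fib-positive (suc n)) (fib≤lucas n))

module _ where
  open import Data.Integer using (+_)

  fibℤ : ℕ → ℤ
  fibℤ 0             = + 0
  fibℤ 1             = + 1
  fibℤ (suc (suc n)) = fibℤ (suc n) ℤ.+ fibℤ n

  lucasℤ : ℕ → ℤ
  lucasℤ zero    = + 2
  lucasℤ (suc n) = fibℤ n ℤ.+ fibℤ (suc (suc n))

  +fib≡fibℤ : ∀ n → + fib n ≡ fibℤ n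
  +fib≡fibℤ 0             = refl
  +fib≡fibℤ 1             = refl
  +fib≡fibℤ (suc (suc n)) = trans (ℤₚ.pos-+ (fib (suc n)) (fib n)) (cong₂ ℤ._+_ (+fib≡fibℤ (suc n)) (+fib≡fibℤ n))

  +lucas≡lucasℤ : ∀ n → + lucas (suc n) ≡ lucasℤ (suc n)
  +lucas≡lucasℤ n = trans (ℤₚ.pos-+ (fib n) (fib (2 + n))) (cong₂ ℤ._+_ (+fib≡fibℤ n) (+fib≡fibℤ (2 + n)))

  cassini : ∀ i → fibℤ (1 + i) ℤ.* fibℤ (1 + i) ℤ.- fibℤ (2 + i) ℤ.* fibℤ i ≡ -1ℤ ℤ.^ i
  cassini zero    = refl
  cassini (suc i) = trans (step (fibℤ i) (fibℤ (1 + i))) (cong (-1ℤ ℤ.*_) (cassini i))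
    where
    step : ∀ x y → (y ℤ.+ x) ℤ.* (y ℤ.+ x) ℤ.- ((y ℤ.+ x) ℤ.+ y) ℤ.* y
                   ≡ -1ℤ ℤ.* (y ℤ.* y ℤ.- (y ℤ.+ x) ℤ.* x)
    step = ℤ-Solver.solve-∀

  lucas²-5fib·fib : ∀ i →
    lucasℤ (1 + i) ℤ.* lucasℤ (1 + i) ℤ.- + 5 ℤ.* (fibℤ i ℤ.* fibℤ (2 + i)) ≡ -1ℤ ℤ.^ i
  lucas²-5fib·fib i = trans (via-cassini (fibℤ i) (fibℤ (1 + i))) (cassini i)
    where
    via-cassini : ∀ x y → (x ℤ.+ (y ℤ.+ x)) ℤ.* (x ℤ.+ (y ℤ.+ x)) ℤ.- + 5 ℤ.* (x ℤ.* (y ℤ.+ x))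
                          ≡ y ℤ.* y ℤ.- (y ℤ.+ x) ℤ.* x
    via-cassini = ℤ-Solver.solve-∀

  dOcagne : ∀ i d →
    fibℤ (2 + i) ℤ.* lucasℤ (1 + (d + i)) ℤ.- fibℤ (2 + (d + i)) ℤ.* lucasℤ (1 + i) ≡ -1ℤ ℤ.^ i ℤ.* fibℤ d
  dOcagne i 0             = trans (self (fibℤ (2 + i)) (lucasℤ (1 + i))) (sym (ℤₚ.*-zeroʳ (-1ℤ ℤ.^ i)))
    where
    self : ∀ a l → a ℤ.* l ℤ.- a ℤ.* l ≡ + 0
    self = ℤ-Solver.solve-∀
  dOcagne i 1             = trans (step (fibℤ i) (fibℤ (1 + i))) (trans (cassini i) (sym (ℤₚ.*-identityʳ (-1ℤ ℤ.^ i))))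
    where
    step : ∀ x y → (y ℤ.+ x) ℤ.* (y ℤ.+ ((y ℤ.+ x) ℤ.+ y)) ℤ.- ((y ℤ.+ x) ℤ.+ y) ℤ.* (x ℤ.+ (y ℤ.+ x))
                   ≡ y ℤ.* y ℤ.- (y ℤ.+ x) ℤ.* x
    step = ℤ-Solver.solve-∀
  dOcagne i (suc (suc d)) =
    trans (fibonacci-step (fibℤ (2 + i)) (lucasℤ (1 + i)) (fibℤ (d + i)) (fibℤ (1 + (d + i))))
          (trans (cong₂ ℤ._+_ (dOcagne i (suc d)) (dOcagne i d))
                 (sym (ℤₚ.*-distribˡ-+ (-1ℤ ℤ.^ i) (fibℤ (suc d)) (fibℤ d))))
    where
    fibonacci-step : ∀ a l p q →
      a ℤ.* ((q ℤ.+ p) ℤ.+ (((q ℤ.+ p) ℤ.+ q) ℤ.+ (q ℤ.+ p))) ℤ.- (((q ℤ.+ p) ℤ.+ q) ℤ.+ (q ℤ.+ p)) ℤ.* l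
        ≡ (a ℤ.* (q ℤ.+ ((q ℤ.+ p) ℤ.+ q)) ℤ.- ((q ℤ.+ p) ℤ.+ q) ℤ.* l)
          ℤ.+ (a ℤ.* (p ℤ.+ (q ℤ.+ p)) ℤ.- (q ℤ.+ p) ℤ.* l)
    fibonacci-step = ℤ-Solver.solve-∀

  ∣-1^i∣≡1 : ∀ i → ℤ.∣ -1ℤ ℤ.^ i ∣ ≡ 1
  ∣-1^i∣≡1 zero    = refl
  ∣-1^i∣≡1 (suc i) = trans (ℤₚ.abs-* -1ℤ (-1ℤ ℤ.^ i)) (trans (*-identityˡ _) (∣-1^i∣≡1 i))

  -- T and S stand for 𝒯₁ of the corona of the path on i+1 vertices and the total size of
  -- the matchings of that path.
  path-cycle-numerator : ∀ i (T S : ℕ) →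
    T + S ≡ suc i * fib (2 + i) → 5 * S + fib (1 + i) ≡ suc i * lucas (1 + i) →
    + 5 ℤ.* (+ fib (2 + i) ℤ.* + (suc i * fib (2 + i)) ℤ.- + T ℤ.* + lucas (1 + i))
      ≡ + suc i ℤ.* -1ℤ ℤ.^ i ℤ.- fibℤ (1 + i) ℤ.* lucasℤ (1 + i)
  path-cycle-numerator i T S T+S≡NF 5S+F≡NL = begin
    + 5 ℤ.* (+ fib (2 + i) ℤ.* + (suc i * fib (2 + i)) ℤ.- + T ℤ.* + lucas (1 + i))
      ≡⟨ cong₂ (λ a b → + 5 ℤ.* (a ℤ.* b ℤ.- + T ℤ.* + lucas (1 + i))) (+fib≡fibℤ (2 + i)) +NF ⟩
    + 5 ℤ.* (F₂ ℤ.* (N ℤ.* F₂) ℤ.- + T ℤ.* + lucas (1 + i))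
      ≡⟨ cong₂ (λ t l → + 5 ℤ.* (F₂ ℤ.* (N ℤ.* F₂) ℤ.- t ℤ.* l)) +T (+lucas≡lucasℤ i) ⟩
    + 5 ℤ.* (F₂ ℤ.* (N ℤ.* F₂) ℤ.- (N ℤ.* F₂ ℤ.- + S) ℤ.* L)
      ≡⟨ expand N F₀ F₁ (+ S) ⟩
    N ℤ.* (L ℤ.* L ℤ.- + 5 ℤ.* (F₀ ℤ.* F₂)) ℤ.- N ℤ.* L ℤ.* L ℤ.+ (+ 5 ℤ.* + S) ℤ.* L
      ≡⟨ cong (λ z → N ℤ.* (L ℤ.* L ℤ.- + 5 ℤ.* (F₀ ℤ.* F₂)) ℤ.- N ℤ.* L ℤ.* L ℤ.+ z ℤ.* L) +5S ⟩
    N ℤ.* (L ℤ.* L ℤ.- + 5 ℤ.* (F₀ ℤ.* F₂)) ℤ.- N ℤ.* L ℤ.* L ℤ.+ (N ℤ.* L ℤ.- F₁) ℤ.* L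
      ≡⟨ collect N (L ℤ.* L ℤ.- + 5 ℤ.* (F₀ ℤ.* F₂)) L F₁ ⟩
    N ℤ.* (L ℤ.* L ℤ.- + 5 ℤ.* (F₀ ℤ.* F₂)) ℤ.- F₁ ℤ.* L
      ≡⟨ cong (λ z → N ℤ.* z ℤ.- F₁ ℤ.* L) (lucas²-5fib·fib i) ⟩
    N ℤ.* -1ℤ ℤ.^ i ℤ.- F₁ ℤ.* L ∎
    where
    open ≡-Reasoning
    N = + suc i
    F₀ = fibℤ i
    F₁ = fibℤ (1 + i)
    F₂ = fibℤ (2 + i)
    L = lucasℤ (1 + i)
    +NF : + (suc i * fib (2 + i)) ≡ N ℤ.* F₂
    +NF = trans (ℤₚ.pos-* (suc i) _) (cong (N ℤ.*_) (+fib≡fibℤ (2 + i)))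
    move : ∀ a b c → a ℤ.+ b ≡ c → a ≡ c ℤ.- b
    move a b c e = trans (cancel a b) (cong (ℤ._- b) e)
      where
      cancel : ∀ a b → a ≡ a ℤ.+ b ℤ.- b
      cancel = ℤ-Solver.solve-∀
    +T : + T ≡ N ℤ.* F₂ ℤ.- + S
    +T = move (+ T) (+ S) _ (trans (sym (ℤₚ.pos-+ T S)) (trans (cong +_ T+S≡NF) +NF))
    +5S : + 5 ℤ.* + S ≡ N ℤ.* L ℤ.- F₁
    +5S = move (+ 5 ℤ.* + S) F₁ _ (trans (cong₂ ℤ._+_ (sym (ℤₚ.pos-* 5 S)) (sym (+fib≡fibℤ (1 + i))))
            (trans (sym (ℤₚ.pos-+ (5 * S) (fib (1 + i)))) (trans (cong +_ 5S+F≡NL)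
              (trans (ℤₚ.pos-* (suc i) _) (cong (N ℤ.*_) (+lucas≡lucasℤ i))))))
    expand : ∀ N x y s →
      + 5 ℤ.* ((y ℤ.+ x) ℤ.* (N ℤ.* (y ℤ.+ x)) ℤ.- (N ℤ.* (y ℤ.+ x) ℤ.- s) ℤ.* (x ℤ.+ (y ℤ.+ x)))
        ≡ N ℤ.* ((x ℤ.+ (y ℤ.+ x)) ℤ.* (x ℤ.+ (y ℤ.+ x)) ℤ.- + 5 ℤ.* (x ℤ.* (y ℤ.+ x)))
          ℤ.- N ℤ.* (x ℤ.+ (y ℤ.+ x)) ℤ.* (x ℤ.+ (y ℤ.+ x)) ℤ.+ (+ 5 ℤ.* s) ℤ.* (x ℤ.+ (y ℤ.+ x))
    expand = ℤ-Solver.solve-∀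
    collect : ∀ N c l y → N ℤ.* c ℤ.- N ℤ.* l ℤ.* l ℤ.+ (N ℤ.* l ℤ.- y) ℤ.* l ≡ N ℤ.* c ℤ.- y ℤ.* l
    collect = ℤ-Solver.solve-∀

module _ where
  open import Data.Integer using (+_; +0; +[1+_]; -[1+_])
  open import Data.Rational using (mkℚ; _/_; toℚᵘ; ∣_∣; 0ℚ; *<*)
  open import Data.Rational.Unnormalised as ℚᵘ using (mkℚᵘ; *≤*)
  import Data.Rational.Unnormalised.Properties as ℚᵘₚ
  import Data.Rational.Properties as ℚₚ
  open import Data.Rational.Solver using (module +-*-Solver)

  1/[1+_] : ℕ → ℚ
  1/[1+ b ] = + 1 / suc b

  private
    toℚᵘ-/ : ∀ p d → toℚᵘ ((+ p) / suc d) ℚᵘ.≃ mkℚᵘ (+ p) d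
    toℚᵘ-/ p d = ℚₚ.toℚᵘ-fromℚᵘ (mkℚᵘ (+ p) d)

  ∣p/q-r/s∣≤1/[1+b] : ∀ p q r s b .{{_ : ℕ.NonZero q}} .{{_ : ℕ.NonZero s}} →
    ℤ.∣ + p ℤ.* + s ℤ.- + r ℤ.* + q ∣ * suc b ≤ q * s → ∣ (+ p) / q ℚ.- (+ r) / s ∣ ℚ.≤ 1/[1+ b ]
  ∣p/q-r/s∣≤1/[1+b] p (suc q) r (suc s) b h = ℚₚ.toℚᵘ-cancel-≤
    (ℚᵘₚ.≤-respʳ-≃ (ℚᵘₚ.≃-sym (toℚᵘ-/ 1 b))
                   (ℚᵘₚ.≤-respˡ-≃ (ℚᵘₚ.≃-sym toℚᵘ-distance) (*≤* cross-multiplied)))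
    where
    x = (+ p) / suc q
    y = (+ r) / suc s
    toℚᵘ-distance : toℚᵘ ∣ x ℚ.- y ∣ ℚᵘ.≃ ℚᵘ.∣ mkℚᵘ (+ p) q ℚᵘ.- mkℚᵘ (+ r) s ∣
    toℚᵘ-distance = ℚᵘₚ.≃-trans (ℚₚ.toℚᵘ-homo-∣-∣ (x ℚ.- y))
      (ℚᵘₚ.∣-∣-cong (ℚᵘₚ.≃-trans (ℚₚ.toℚᵘ-homo-+ x (ℚ.- y))
      (ℚᵘₚ.+-cong (toℚᵘ-/ p q) (ℚᵘₚ.≃-trans (ℚₚ.toℚᵘ-homo‿- y) (ℚᵘₚ.-‿cong (toℚᵘ-/ r s))))))
    minus : ∀ (a b c d : ℤ) → a ℤ.* b ℤ.+ (ℤ.- c) ℤ.* d ≡ a ℤ.* b ℤ.- c ℤ.* d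
    minus = ℤ-Solver.solve-∀
    cross-multiplied :
      + ℤ.∣ + p ℤ.* + suc s ℤ.+ (ℤ.- + r) ℤ.* + suc q ∣ ℤ.* + suc b ℤ.≤ + 1 ℤ.* + (suc q * suc s)
    cross-multiplied = subst₂ ℤ._≤_
      (trans (ℤₚ.pos-* ℤ.∣ + p ℤ.* + suc s ℤ.- + r ℤ.* + suc q ∣ (suc b))
             (cong (λ z → + ℤ.∣ z ∣ ℤ.* + suc b) (sym (minus (+ p) (+ suc s) (+ r) (+ suc q)))))
      (sym (ℤₚ.*-identityˡ _)) (ℤ.+≤+ h)

  /-cross : ∀ p q r s .{{_ : ℕ.NonZero q}} .{{_ : ℕ.NonZero s}} → p * s ≡ r * q → (+ p) / q ≡ (+ r) / s
  /-cross p (suc q) r (suc s) e = ℚₚ.fromℚᵘ-cong {mkℚᵘ (+ p) q} {mkℚᵘ (+ r) s}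
    (ℚᵘ.*≡* (trans (sym (ℤₚ.pos-* p (suc s))) (trans (cong +_ e) (ℤₚ.pos-* r (suc q)))))

  1/[1+]-antitone : ∀ {m n} → m ≤ n → 1/[1+ n ] ℚ.≤ 1/[1+ m ]
  1/[1+]-antitone {m} {n} m≤n = ℚₚ.toℚᵘ-cancel-≤
    (ℚᵘₚ.≤-respˡ-≃ (ℚᵘₚ.≃-sym (toℚᵘ-/ 1 n)) (ℚᵘₚ.≤-respʳ-≃ (ℚᵘₚ.≃-sym (toℚᵘ-/ 1 m))
      (*≤* (subst₂ ℤ._≤_ (sym (ℤₚ.*-identityˡ (+ suc m))) (sym (ℤₚ.*-identityˡ (+ suc n))) (ℤ.+≤+ (s≤s m≤n))))))

  archimedean : ∀ ε → 0ℚ ℚ.< ε → ∃ λ b → 1/[1+ b ] ℚ.< ε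
  archimedean (mkℚ +[1+ p ] d _) _ =
    suc d , ℚₚ.toℚᵘ-cancel-< (ℚᵘₚ.<-respˡ-≃ (ℚᵘₚ.≃-sym (toℚᵘ-/ 1 (suc d))) (ℚᵘ.*<* cross))
    where
    cross : + 1 ℤ.* + suc d ℤ.< +[1+ p ] ℤ.* + suc (suc d)
    cross = subst₂ ℤ._<_ (sym (ℤₚ.pos-* 1 (suc d))) (sym (ℤₚ.pos-* (suc p) (suc (suc d))))
      (ℤ.+<+ (begin-strict
        1 * suc d          <⟨ s≤s (≤-reflexive (*-identityˡ (suc d))) ⟩
        suc (suc d)        ≤⟨ m≤m*n (suc (suc d)) (suc p) ⟩
        suc (suc d) * suc p ≡⟨ *-comm (suc (suc d)) (suc p) ⟩
        suc p * suc (suc d) ∎))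
      where open ≤-Reasoning
  archimedean (mkℚ +0       d _) (*<* (ℤ.+<+ ()))
  archimedean (mkℚ -[1+ p ] d _) (*<* ())

  open +-*-Solver

  ∣-∣-sym : ∀ p q → ∣ p ℚ.- q ∣ ≡ ∣ q ℚ.- p ∣
  ∣-∣-sym p q = trans (cong ∣_∣ (sym (neg-diff p q))) (ℚₚ.∣-p∣≡∣p∣ (q ℚ.- p))
    where
    neg-diff : ∀ p q → ℚ.- (q ℚ.- p) ≡ p ℚ.- q
    neg-diff = solve 2 (λ p q → (:- (q :- p)) := (p :- q)) refl

  cauchy-from-rate : (x : ℕ → ℚ) → (∀ m n → m ≤ n → ∣ x m ℚ.- x n ∣ ℚ.≤ 1/[1+ m ]) → Cauchy x
  cauchy-from-rate x rate ε ε>0 with archimedean ε ε>0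
  ... | b , 1/[1+b]<ε = b , close
    where
    close : ∀ m n → b ≤ m → b ≤ n → ∣ x m ℚ.- x n ∣ ℚ.< ε
    close m n b≤m b≤n with ≤-total m n
    ... | inj₁ m≤n = ℚₚ.≤-<-trans (ℚₚ.≤-trans (rate m n m≤n) (1/[1+]-antitone b≤m)) 1/[1+b]<ε
    ... | inj₂ n≤m = ℚₚ.≤-<-trans (subst (ℚ._≤ 1/[1+ b ]) (∣-∣-sym (x n) (x m))
                                           (ℚₚ.≤-trans (rate n m n≤m) (1/[1+]-antitone b≤n))) 1/[1+b]<ε

  diffToZero-from-rate : (x y : ℕ → ℚ) → (∀ n → ∣ x n ℚ.- y n ∣ ℚ.≤ 1/[1+ n ]) → DiffToZero x y
  diffToZero-from-rate x y rate ε ε>0 with archimedean ε ε>0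
  ... | b , 1/[1+b]<ε = b , λ n b≤n → ℚₚ.≤-<-trans (ℚₚ.≤-trans (rate n) (1/[1+]-antitone b≤n)) 1/[1+b]<ε

  cauchy-transfer : (x y : ℕ → ℚ) → Cauchy x → DiffToZero x y → Cauchy y
  cauchy-transfer x y x-cauchy x-y→0 ε ε>0 =
    let N₁ , x-close  = x-cauchy (ε ℚ.* ⅓) ε/3>0
        N₂ , xy-close = x-y→0 (ε ℚ.* ⅓) ε/3>0
    in N₁ ⊔ N₂ , λ m n m≥N n≥N →
    let N₁≤m = ≤-trans (m≤m⊔n N₁ N₂) m≥N
        N₁≤n = ≤-trans (m≤m⊔n N₁ N₂) n≥N
        N₂≤m = ≤-trans (m≤n⊔m N₁ N₂) m≥N
        N₂≤n = ≤-trans (m≤n⊔m N₁ N₂) n≥N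
    in subst (∣ y m ℚ.- y n ∣ ℚ.<_) (thirds ε)
         (ℚₚ.≤-<-trans (triangle (y m) (x m) (x n) (y n))
           (ℚₚ.+-mono-< (ℚₚ.+-mono-< (subst (ℚ._< ε ℚ.* ⅓) (∣-∣-sym (x m) (y m)) (xy-close m N₂≤m))
                                     (x-close m n N₁≤m N₁≤n))
                        (xy-close n N₂≤n)))
    where
    ⅓ = + 1 / 3
    ε/3>0 : 0ℚ ℚ.< ε ℚ.* ⅓
    ε/3>0 = subst (ℚ._< ε ℚ.* ⅓) (ℚₚ.*-zeroˡ ⅓) (ℚₚ.*-monoˡ-<-pos ⅓ ε>0)
    thirds : ∀ e → e ℚ.* ⅓ ℚ.+ e ℚ.* ⅓ ℚ.+ e ℚ.* ⅓ ≡ e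
    thirds e = trans (solve 2 (λ e t → e :* t :+ e :* t :+ e :* t := e :* (t :+ t :+ t)) refl e ⅓) (ℚₚ.*-identityʳ e)
    telescope : ∀ a b c d → a ℚ.- d ≡ (a ℚ.- b) ℚ.+ (b ℚ.- c) ℚ.+ (c ℚ.- d)
    telescope = solve 4 (λ a b c d → a :- d := (a :- b) :+ (b :- c) :+ (c :- d)) refl
    triangle : ∀ a b c d → ∣ a ℚ.- d ∣ ℚ.≤ ∣ a ℚ.- b ∣ ℚ.+ ∣ b ℚ.- c ∣ ℚ.+ ∣ c ℚ.- d ∣
    triangle a b c d =
      subst (ℚ._≤ ∣ a ℚ.- b ∣ ℚ.+ ∣ b ℚ.- c ∣ ℚ.+ ∣ c ℚ.- d ∣) (cong ∣_∣ (sym (telescope a b c d)))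
      (ℚₚ.≤-trans (ℚₚ.∣p+q∣≤∣p∣+∣q∣ (a ℚ.- b ℚ.+ (b ℚ.- c)) (c ℚ.- d))
                  (ℚₚ.+-monoˡ-≤ ∣ c ℚ.- d ∣ (ℚₚ.∣p+q∣≤∣p∣+∣q∣ (a ℚ.- b) (b ℚ.- c))))

  fib/lucas : ℕ → ℚ
  fib/lucas i = ((+ fib (2 + i)) / lucas (1 + i)) {{lucas-nonZero i}}

  fib/lucas-close : ∀ i d b → suc b ≤ lucas (1 + i) → ∣ fib/lucas i ℚ.- fib/lucas (d + i) ∣ ℚ.≤ 1/[1+ b ]
  fib/lucas-close i d b 1+b≤L =
    ∣p/q-r/s∣≤1/[1+b] (fib (2 + i)) (lucas (1 + i)) (fib (2 + (d + i))) (lucas (1 + (d + i))) b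
                      {{lucas-nonZero i}} {{lucas-nonZero (d + i)}}
      (subst (λ z → z * suc b ≤ lucas (1 + i) * lucas (1 + (d + i))) (sym numerator)
        (subst (fib d * suc b ≤_) (*-comm (lucas (1 + (d + i))) _) (*-mono-≤ fib-d≤L 1+b≤L)))
    where
    fib-d≤L : fib d ≤ lucas (1 + (d + i))
    fib-d≤L = ≤-trans (fib-monotone (≤-trans (m≤m+n d (2 + i)) (≤-reflexive (+-suc-suc d i)))) (fib≤lucas (d + i))
      where
      +-suc-suc : ∀ d i → d + (2 + i) ≡ 2 + (d + i)
      +-suc-suc d i = trans (+-suc d (suc i)) (cong suc (+-suc d i))
    numerator : ℤ.∣ + fib (2 + i) ℤ.* + lucas (1 + (d + i)) ℤ.- + fib (2 + (d + i)) ℤ.* + lucas (1 + i) ∣ ≡ fib d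
    numerator = begin
      ℤ.∣ + fib (2 + i) ℤ.* + lucas (1 + (d + i)) ℤ.- + fib (2 + (d + i)) ℤ.* + lucas (1 + i) ∣
        ≡⟨ cong ℤ.∣_∣ (cong₂ ℤ._-_ (cong₂ ℤ._*_ (+fib≡fibℤ (2 + i)) (+lucas≡lucasℤ (d + i)))
                                  (cong₂ ℤ._*_ (+fib≡fibℤ (2 + (d + i))) (+lucas≡lucasℤ i))) ⟩
      ℤ.∣ fibℤ (2 + i) ℤ.* lucasℤ (1 + (d + i)) ℤ.- fibℤ (2 + (d + i)) ℤ.* lucasℤ (1 + i) ∣
        ≡⟨ cong ℤ.∣_∣ (dOcagne i d) ⟩
      ℤ.∣ -1ℤ ℤ.^ i ℤ.* fibℤ d ∣
        ≡⟨ ℤₚ.abs-* (-1ℤ ℤ.^ i) (fibℤ d) ⟩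
      ℤ.∣ -1ℤ ℤ.^ i ∣ * ℤ.∣ fibℤ d ∣
        ≡⟨ cong₂ _*_ (∣-1^i∣≡1 i) (cong ℤ.∣_∣ (sym (+fib≡fibℤ d))) ⟩
      1 * fib d
        ≡⟨ *-identityˡ (fib d) ⟩
      fib d ∎
      where open ≡-Reasoning

  path-cycle-close : ∀ i k (T S : ℕ) → k ≤ i →
    T + S ≡ suc i * fib (2 + i) → 5 * S + fib (1 + i) ≡ suc i * lucas (1 + i) →
    ∣ fib/lucas i ℚ.- ((+ T) / (suc i * fib (2 + i))) {{m*n≢0 (suc i) _ {{_}} {{fib-nonZero (1 + i)}}}} ∣ ℚ.≤ 1/[1+ k ]
  path-cycle-close i k T S k≤i T+S≡NF 5S+F≡NL =
    ∣p/q-r/s∣≤1/[1+b] F₂ L T (N * F₂) k {{lucas-nonZero i}} {{m*n≢0 N _ {{_}} {{fib-nonZero (1 + i)}}}}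
      (*-cancelˡ-≤ 5 (begin
        5 * (D * suc k)                      ≡⟨ *-assoc 5 D (suc k) ⟨
        5 * D * suc k                        ≤⟨ *-mono-≤ five-D≤ (s≤s k≤i) ⟩
        (N + F₁ * L) * N                     ≤⟨ *-monoˡ-≤ N (+-mono-≤ N≤F₂L (*-monoˡ-≤ L (m≤m+n F₁ (fib i)))) ⟩
        (F₂ * L + F₂ * L) * N                ≤⟨ *-monoˡ-≤ N (+-monoʳ-≤ (F₂ * L) (m≤n+m (F₂ * L) (3 * (F₂ * L)))) ⟩
        (F₂ * L + (3 * (F₂ * L) + F₂ * L)) * N ≡⟨ collect F₂ L N ⟩
        5 * (L * (N * F₂))                   ∎))
    where
    open ≤-Reasoning
    N  = suc i
    F₁ = fib (1 + i)
    F₂ = fib (2 + i)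
    L  = lucas (1 + i)
    D  = ℤ.∣ + F₂ ℤ.* + (N * F₂) ℤ.- + T ℤ.* + L ∣
    five-D≤ : 5 * D ≤ N + F₁ * L
    five-D≤ = begin
      5 * D                                              ≡⟨ ℤₚ.abs-* (+ 5) (+ F₂ ℤ.* + (N * F₂) ℤ.- + T ℤ.* + L) ⟨
      ℤ.∣ + 5 ℤ.* (+ F₂ ℤ.* + (N * F₂) ℤ.- + T ℤ.* + L) ∣ ≡⟨ cong ℤ.∣_∣ (path-cycle-numerator i T S T+S≡NF 5S+F≡NL) ⟩
      ℤ.∣ + N ℤ.* -1ℤ ℤ.^ i ℤ.- fibℤ (1 + i) ℤ.* lucasℤ (1 + i) ∣
        ≤⟨ ℤₚ.∣i-j∣≤∣i∣+∣j∣ (+ N ℤ.* -1ℤ ℤ.^ i) (fibℤ (1 + i) ℤ.* lucasℤ (1 + i)) ⟩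
      ℤ.∣ + N ℤ.* -1ℤ ℤ.^ i ∣ + ℤ.∣ fibℤ (1 + i) ℤ.* lucasℤ (1 + i) ∣
        ≡⟨ cong₂ _+_ (trans (ℤₚ.abs-* (+ N) (-1ℤ ℤ.^ i)) (trans (cong (N *_) (∣-1^i∣≡1 i)) (*-identityʳ N)))
                     (trans (ℤₚ.abs-* (fibℤ (1 + i)) (lucasℤ (1 + i)))
                            (cong₂ _*_ (cong ℤ.∣_∣ (sym (+fib≡fibℤ (1 + i)))) (cong ℤ.∣_∣ (sym (+lucas≡lucasℤ i))))) ⟩
      N + F₁ * L                                         ∎
    N≤F₂L : N ≤ F₂ * L
    N≤F₂L = ≤-trans (fib-≥ i) (subst (_≤ F₂ * L) (*-identityʳ F₂)
                                     (*-monoʳ-≤ F₂ (≤-trans (fib-positive (suc i)) (fib≤lucas i))))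
    collect : ∀ a l n → (a * l + (3 * (a * l) + a * l)) * n ≡ 5 * (l * (n * a))
    collect = solve-∀

  ratio≡/ : ∀ t d .{{_ : ℕ.NonZero d}} → ratio t d ≡ (+ t) / d
  ratio≡/ t (suc d) = refl

  ℐ-cycle : ∀ k → ℐ (corona (cycle+3 k)) ≡ fib/lucas (2 + k)
  ℐ-cycle k = begin
    ℐ (corona (cycle+3 k))                              ≡⟨ ℐ≡ratio (corona (cycle+3 k)) (ν-cycle k) ⟩
    ratio (𝒯₁ (corona (cycle+3 k))) (N * 𝒯₀ (corona (cycle+3 k)))
                                                        ≡⟨ cong₂ ratio (𝒯₁-cycle k) (cong (N *_) (𝒯₀-cycle k)) ⟩
    ratio (N * fib (4 + k)) (N * lucas (3 + k))         ≡⟨ ratio≡/ (N * fib (4 + k)) (N * lucas (3 + k)) {{N*L≢0}} ⟩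
    ((+ (N * fib (4 + k))) / (N * lucas (3 + k))) {{N*L≢0}}
      ≡⟨ /-cross (N * fib (4 + k)) (N * lucas (3 + k)) (fib (4 + k)) (lucas (3 + k))
                 {{N*L≢0}} {{lucas-nonZero (2 + k)}} cross ⟩
    fib/lucas (2 + k) ∎
    where
    open ≡-Reasoning
    N = 3 + k
    N*L≢0 = m*n≢0 N (lucas (3 + k)) {{_}} {{lucas-nonZero (2 + k)}}
    cross : N * fib (4 + k) * lucas (3 + k) ≡ fib (4 + k) * (N * lucas (3 + k))
    cross = rearrange N (fib (4 + k)) (lucas (3 + k))
      where
      rearrange : ∀ n f l → n * f * l ≡ f * (n * l)
      rearrange = solve-∀

  ℐ-path : ∀ k → ℐ (corona (path (3 + k))) ≡
    ((+ 𝒯₁ (corona (path (3 + k)))) / ((3 + k) * fib (4 + k))) {{m*n≢0 (3 + k) _ {{_}} {{fib-nonZero (3 + k)}}}}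
  ℐ-path k = trans (ℐ≡ratio (corona (path (3 + k))) (ν-path k))
    (trans (cong (λ z → ratio (𝒯₁ (corona (path (3 + k)))) ((3 + k) * z)) (𝒯₀-path k))
           (ratio≡/ _ ((3 + k) * fib (4 + k)) {{m*n≢0 (3 + k) _ {{_}} {{fib-nonZero (3 + k)}}}}))

  cycle-rate : ∀ m n → m ≤ n → ∣ ℐ (corona (cycle+3 m)) ℚ.- ℐ (corona (cycle+3 n)) ∣ ℚ.≤ 1/[1+ m ]
  cycle-rate m n m≤n = subst₂ (λ x y → ∣ x ℚ.- y ∣ ℚ.≤ 1/[1+ m ]) (sym (ℐ-cycle m)) (sym (ℐ-cycle n))
    (subst (λ j → ∣ fib/lucas (2 + m) ℚ.- fib/lucas j ∣ ℚ.≤ 1/[1+ m ]) n∸m+[2+m]≡2+n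
      (fib/lucas-close (2 + m) (n ∸ m) m (≤-trans (m≤n+m (suc m) 2) (≤-trans (fib-≥ (2 + m)) (fib≤lucas (2 + m))))))
    where
    n∸m+[2+m]≡2+n : n ∸ m + (2 + m) ≡ 2 + n
    n∸m+[2+m]≡2+n = trans (+-comm (n ∸ m) (2 + m)) (cong (λ j → 2 + j) (m+[n∸m]≡n m≤n))

  path-cycle-rate : ∀ n → ∣ ℐ (corona (cycle+3 n)) ℚ.- ℐ (corona (path (3 + n))) ∣ ℚ.≤ 1/[1+ n ]
  path-cycle-rate n = subst₂ (λ x y → ∣ x ℚ.- y ∣ ℚ.≤ 1/[1+ n ]) (sym (ℐ-cycle n)) (sym (ℐ-path n))
    (path-cycle-close (2 + n) n (𝒯₁ (corona (path (3 + n)))) (sizeSum-path (2 + n)) (m≤n+m n 2)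
                      (𝒯₁-path n) (sizeSum-path-closed (2 + n)))

corollary4 : SameLimit (λ k → ℐ (corona (cycle+3 k))) (λ k → ℐ (corona (path (3 + k))))
corollary4 = cycles-cauchy , cauchy-transfer cycles paths cycles-cauchy cycles-paths→0 , cycles-paths→0
  where
  cycles paths : ℕ → ℚ
  cycles k = ℐ (corona (cycle+3 k))
  paths  k = ℐ (corona (path (3 + k)))
  cycles-cauchy  = cauchy-from-rate cycles cycle-rate
  cycles-paths→0 = diffToZero-from-rate cycles paths path-cycle-rate
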